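{- Let $\alpha,n\in\mathbb{Z}^+$ and $\beta=n/\alpha$. Let $\mathcal{S}=\{k_s\in\mathbb{Z}^+:k_s\mid\alpha\}$ and, for $k_s\in\mathcal{S}$, \[\mathcal{R}_{k_s}=\{k_r\in\mathbb{Z}_{\ge0}:\ k_s\mid k_r,\ \ k_s\beta/(k_s+k_r)\in\mathbb{Z},\ \ (k_s=\alpha\iff k_r=0)\}.\] Define \[\Psi_{(\alpha,[n],(k_s,k_r))}=\begin{cases}0,& \alpha\nmid n,\\ 1,& k_r=0,\\ \Big|\mathcal{T}\big(\alpha/k_s,\big[\tfrac{n}{k_s+k_r}\big]\big)\Big|-\Big|\mathcal{T}\big(\alpha/k_s,\big[\tfrac{n}{k_s+k_r}\big],(1,\cdot)\big)\Big|,&\text{otherwise.}\end{cases}\] Then \[|\mathcal{T}(\alpha,[n])|=\sum_{k_s\in\mathcal{S}}\ \sum_{k_r\in\mathcal{R}_{k_s}}\Psi_{(\alpha,[n],(k_s,k_r))}.\]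
   Context: $[n]=\{1,\dots,n\}$. $A+B$ is the Minkowski sum. For finite $C\subset\mathbb{Z}$ and $\alpha\in\mathbb{Z}^+$, $\mathcal{T}(\alpha,C)$ is the set of pairs $(A,B)$ of finite subsets of $\mathbb{Z}$ with $A+B=C$, $|C|=|A||B|$, $|A|=\alpha$, $0\in B$ and $\min B\ge0$. For $(A,B)\in\mathcal{T}(\alpha,[m])$ (then $1\in A$), the first segment is $s_1=\{x\in A: x<\min([m]\setminus A)\}$ (with $s_1=A$ if $A=[m]$), i.e. the maximal run of consecutive integers in $A$ starting at $1$. $\mathcal{T}(\alpha,[m],(1,\cdot))$ denotes the set of $(A,B)\in\mathcal{T}(\alpha,[m])$ with $|s_1|=1$. -}

module Defs where

open import Data.Nat as ℕ using (ℕ; zero; suc; _∸_; _≤_; NonZero)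
open import Data.Nat.Divisibility using (_∣_; _∣?_)
open import Data.Nat.DivMod using (_/_)
open import Data.Integer as ℤ using (ℤ; +_; _<?_)
open import Data.List using (List; []; _∷_; map; upTo; length; filter)
open import Data.Nat.ListAction using (sum)
open import Data.List.Relation.Unary.Linked using (Linked)
open import Data.List.Relation.Unary.All using (All)
open import Data.List.Relation.Unary.Unique.Propositional using (Unique)
open import Data.List.Membership.Propositional using (_∈_)
open import Data.List.Membership.DecPropositional ℤ._≟_ using (_∈?_)
open import Data.Maybe using (Maybe; just; nothing)
open import Data.Product using (Σ; ∃; ∃-syntax; _×_; _,_; proj₁)
open import Data.Bool using (if_then_else_)
open import Relation.Nullary using (Dec; does; ¬_)
open import Relation.Nullary.Decidable using (_×-dec_; _→-dec_)
open import Relation.Binary.PropositionalEquality using (_≡_)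
open import Function.Bundles using (_⇔_)

-- A finite subset of ℤ is represented canonically by its strictly
-- increasing list of elements (each finite set has exactly one such list).
Strict : List ℤ → Set
Strict = Linked ℤ._<_

interval : ℕ → List ℤ
interval m = map (λ i → + suc i) (upTo m)

𝒯 : ℕ → List ℤ → List ℤ × List ℤ → Set
𝒯 α C (A , B) =
  Strict A × Strict B ×
  (∀ z → z ∈ C ⇔ (∃[ a ] ∃[ b ] (a ∈ A × b ∈ B × z ≡ a ℤ.+ b))) ×
  length C ≡ length A ℕ.* length B ×
  length A ≡ α ×
  (+ 0) ∈ B ×
  All (λ b → + 0 ℤ.≤ b) B

firstGap : List ℤ → List ℤ → Maybe ℤ
firstGap [] A = nothing
firstGap (x ∷ xs) A = if does (x ∈? A) then firstGap xs A else just x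

firstSeg : ℕ → List ℤ → List ℤ
firstSeg m A with firstGap (interval m) A
... | nothing = A
... | just g  = filter (λ x → x <? g) A

𝒯₁ : ℕ → ℕ → List ℤ × List ℤ → Set
𝒯₁ α m p = 𝒯 α (interval m) p × length (firstSeg m (proj₁ p)) ≡ 1

HasCard : {X : Set} → (X → Set) → ℕ → Set
HasCard {X} P k =
  Σ (List X) λ L → Unique L × (∀ x → x ∈ L ⇔ P x) × length L ≡ k

-- k_r ∈ 𝓡_{k_s}, with β = n/α unfolded:
-- k_s β/(k_s+k_r) ∈ ℤ  ⟺  α (k_s + k_r) ∣ k_s n
InR : ℕ → ℕ → ℕ → ℕ → Set
InR α n ks kr =
  ks ∣ kr × (α ℕ.* (ks ℕ.+ kr)) ∣ (ks ℕ.* n) ×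
  (ks ≡ α → kr ≡ 0) × (kr ≡ 0 → ks ≡ α)

InR? : ∀ α n ks kr → Dec (InR α n ks kr)
InR? α n ks kr =
  (ks ∣? kr) ×-dec ((α ℕ.* (ks ℕ.+ kr)) ∣? (ks ℕ.* n)) ×-dec
  ((ks ℕ.≟ α) →-dec (kr ℕ.≟ 0)) ×-dec ((kr ℕ.≟ 0) →-dec (ks ℕ.≟ α))

-- Ψ_(α,[n],(k_s,k_r)) with k_s = suc i, where c a m = |𝒯(a,[m])|
-- and c₁ a m = |𝒯(a,[m],(1,·))|.
Ψ : (c c₁ : ℕ → ℕ → ℕ) → ℕ → ℕ → ℕ → ℕ → ℕ
Ψ c c₁ α n i kr =
  if does (α ∣? n) then
    (if does (kr ℕ.≟ 0) then 1
     else c (α / suc i) (n / (suc i ℕ.+ kr)) ∸ c₁ (α / suc i) (n / (suc i ℕ.+ kr)))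
  else 0

-- Σ_{k_s ∈ 𝒮} Σ_{k_r ∈ 𝓡_{k_s}} Ψ.  k_s = suc i ranges over [1, α] (filtered by
-- k_s ∣ α); k_r ranges over [0, k_s n] (filtered by InR), which contains 𝓡_{k_s}
-- since α (k_s + k_r) ∣ k_s n with k_s n > 0 forces k_r ≤ k_s n.
RHS : (c c₁ : ℕ → ℕ → ℕ) → ℕ → ℕ → ℕ
RHS c c₁ α n =
  sum (map (λ i →
    if does (suc i ∣? α) then
      sum (map (λ kr → if does (InR? α n (suc i) kr) then Ψ c c₁ α n i kr else 0)
               (upTo (suc (suc i ℕ.* n))))
    else 0) (upTo α))

-- Shifting A down by one turns (A , B) ∈ 𝒯(α, [n]) into a tiling X ⊕ Y = {0, …, n - 1} with
-- 0 ∈ X ∩ Y. By de Bruijn's structure theorem, if X begins with the run {0, …, K - 1} then K ∣ n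
-- and the tiling is the K-fold inflation (X = K·X₁ + {0, …, K - 1}, Y = K·Y₁) of a tiling
-- (X₁ , Y₁) of {0, …, n / K - 1}. Since K ∉ X we have 1 ∈ Y₁, so applying the theorem once more,
-- with the sides swapped, to the initial run {0, …, J - 1} of Y₁ shows: either Y₁ is everything
-- (the single tiling with k_s = α, k_r = 0), or (X , Y) is obtained from a tiling (X′ , Y′) of
-- {0, …, n / (JK) - 1} with |X′| = α / K and 1 ∈ X′ — equivalently, a pair of
-- 𝒯(α / k_s, [n / (k_s + k_r)]) whose first segment is not of length 1 — where k_s = K and
-- k_r = (J - 1) K. Conversely every such (k_s, k_r, X′, Y′) gives a tiling, and K and J can be
-- read back as the lengths of the first two runs of X, so this is a bijection onto the set
-- counted by the right-hand side.
module Submission where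

open import Defs
open import Data.Nat using (ℕ; _≤_)
open import Data.List using (List)

open import Data.Bool using (if_then_else_)
open import Data.Empty using (⊥; ⊥-elim)
open import Data.Integer as ℤ using (ℤ)
import Data.Integer.Properties as ℤP
open import Data.List using ([]; _∷_; _++_; map; filter; length; upTo; concatMap; cartesianProduct)
import Data.List.Properties as List
open import Data.List.Properties using (length-map; length-upTo; length-++)
open import Data.List.Membership.Propositional using (_∈_; _∉_; find; lose)
open import Data.List.Membership.Propositional.Properties
open import Data.List.Membership.DecPropositional ℤ._≟_ using (_∈?_)
open import Data.List.Relation.Unary.All as All using (All; []; _∷_)
open import Data.List.Relation.Unary.AllPairs as AllPairs using ([]; _∷_)
open import Data.List.Relation.Unary.Any as Any using (here; there)
open import Data.List.Relation.Unary.Linked as Linked using (Linked; []; _∷_)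
import Data.List.Relation.Unary.Linked.Properties as Linkedₚ
open import Data.List.Relation.Unary.Unique.Propositional using (Unique)
import Data.List.Relation.Unary.Unique.Propositional.Properties as Uniqueₚ
open import Data.Maybe using (just; nothing)
open import Data.Nat
open import Data.Nat.DivMod
open import Data.Nat.Divisibility using (_∣_; _∣?_; divides; ∣⇒≤; ∣-refl; *-monoʳ-∣)
open import Data.Nat.Induction using (<-rec)
open import Data.Nat.ListAction using (sum)
open import Data.Nat.Properties
open import Algebra.Properties.CommutativeSemigroup +-commutativeSemigroup using (xy∙z≈xz∙y; x∙yz≈y∙xz; x∙yz≈z∙xy)
open import Data.Nat.Tactic.RingSolver using (solve-∀)
open import Data.Product using (∃; ∃₂; _×_; _,_; proj₁; proj₂; uncurry)
import Data.Product.Properties as ×P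
open import Data.Sum using (_⊎_; inj₁; inj₂)
open import Function using (_∘_)
open import Function.Bundles using (_⇔_; mk⇔; Equivalence)
import Function.Properties.Equivalence as ⇔
open import Relation.Nullary
open import Relation.Nullary.Decidable using (_×-dec_)
open import Relation.Unary using (Decidable)
open import Relation.Binary.Definitions using (DecidableEquality)
open import Relation.Binary.PropositionalEquality hiding (J)

open Equivalence using (to; from)

private variable
  A B : Set

-- Lists without repetition

∈-++-∷⇒∈-++ : ∀ {y x : A} xs ys → y ∈ xs ++ x ∷ ys → y ≢ x → y ∈ xs ++ ys
∈-++-∷⇒∈-++ []       ys (here refl) y≢x = ⊥-elim (y≢x refl)
∈-++-∷⇒∈-++ []       ys (there y∈)  _   = y∈
∈-++-∷⇒∈-++ (z ∷ xs) ys (here refl) _   = here refl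
∈-++-∷⇒∈-++ (z ∷ xs) ys (there y∈)  y≢x = there (∈-++-∷⇒∈-++ xs ys y∈ y≢x)

length-++-∷ : ∀ (xs ys : List A) x → length (xs ++ x ∷ ys) ≡ suc (length (xs ++ ys))
length-++-∷ []       ys x = refl
length-++-∷ (z ∷ xs) ys x = cong suc (length-++-∷ xs ys x)

All≢⇒∉ : ∀ {x : A} {xs} → All (x ≢_) xs → x ∉ xs
All≢⇒∉ (x≢y ∷ _)  (here refl) = x≢y refl
All≢⇒∉ (_ ∷ x≢ys) (there x∈)  = All≢⇒∉ x≢ys x∈

Unique-⊆⇒length≤ : ∀ {xs ys : List A} → Unique xs → (∀ {z} → z ∈ xs → z ∈ ys) → length xs ≤ length ys
Unique-⊆⇒length≤ {xs = []}     _            _ = z≤n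
Unique-⊆⇒length≤ {xs = x ∷ xs} (x∉xs ∷ !xs) xs⊆ys with ∈-∃++ (xs⊆ys (here refl))
... | ys₁ , ys₂ , refl = subst (suc (length xs) ≤_) (sym (length-++-∷ ys₁ ys₂ x))
      (s≤s (Unique-⊆⇒length≤ !xs λ z∈ → ∈-++-∷⇒∈-++ ys₁ ys₂ (xs⊆ys (there z∈)) λ { refl → All≢⇒∉ x∉xs z∈ }))

Unique-⊆⊇⇒length≡ : ∀ {xs ys : List A} → Unique xs → Unique ys →
                    (∀ {z} → z ∈ xs → z ∈ ys) → (∀ {z} → z ∈ ys → z ∈ xs) → length xs ≡ length ys
Unique-⊆⊇⇒length≡ !xs !ys xs⊆ys ys⊆xs = ≤-antisym (Unique-⊆⇒length≤ !xs xs⊆ys) (Unique-⊆⇒length≤ !ys ys⊆xs)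

Unique⇒2≤length : ∀ {xs : List A} {x y} → Unique xs → x ∈ xs → y ∈ xs → x ≢ y → 2 ≤ length xs
Unique⇒2≤length {x = x} {y} !xs x∈ y∈ x≢y = Unique-⊆⇒length≤ ((x≢y ∷ []) ∷ [] ∷ []) ⊆xs
  where
    ⊆xs : ∀ {z} → z ∈ x ∷ y ∷ [] → _
    ⊆xs (here refl)         = x∈
    ⊆xs (there (here refl)) = y∈

-- unlike Uniqueₚ.map⁺, f need only be injective on xs
Unique-map⁺ : ∀ {f : A → B} {xs} → Unique xs → (∀ {x y} → x ∈ xs → y ∈ xs → f x ≡ f y → x ≡ y) → Unique (map f xs)
Unique-map⁺ {xs = []}     _            _   = []
Unique-map⁺ {f = f} {x ∷ xs} (x∉xs ∷ !xs) inj =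
  fx∉ xs (λ z∈ → z∈) x∉xs ∷ Unique-map⁺ !xs (λ a b → inj (there a) (there b))
  where
    fx∉ : ∀ zs → (∀ {z} → z ∈ zs → z ∈ xs) → All (x ≢_) zs → All (f x ≢_) (map f zs)
    fx∉ []       _     _            = []
    fx∉ (z ∷ zs) zs⊆xs (x≢z ∷ x≢zs) =
      (λ e → x≢z (inj (here refl) (there (zs⊆xs (here refl))) e)) ∷ fx∉ zs (λ w∈ → zs⊆xs (there w∈)) x≢zs

pigeonhole : DecidableEquality A → ∀ {C : List B} {P : List A} (f : A → B) → Unique C → length P ≤ length C →
             (∀ {c} → c ∈ C → c ∈ map f P) → ∀ {p q} → p ∈ P → q ∈ P → f p ≡ f q → p ≡ q
pigeonhole _≟_ {C} {P} f !C |P|≤|C| onto {p} {q} p∈ q∈ fp≡fq with p ≟ q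
... | yes p≡q = p≡q
... | no p≢q with ∈-∃++ q∈
...   | ys₁ , ys₂ , refl = ⊥-elim (<⇒≱ |C|<|P| |P|≤|C|)
  where
    C⊆fP∖q : ∀ {c} → c ∈ C → c ∈ map f (ys₁ ++ ys₂)
    C⊆fP∖q c∈ with ∈-map⁻ f (onto c∈)
    ... | r , r∈ , refl with r ≟ q
    ...   | yes refl = subst (_∈ map f (ys₁ ++ ys₂)) fp≡fq (∈-map⁺ f (∈-++-∷⇒∈-++ ys₁ ys₂ p∈ p≢q))
    ...   | no r≢q   = ∈-map⁺ f (∈-++-∷⇒∈-++ ys₁ ys₂ r∈ r≢q)
    |C|<|P| : length C < length (ys₁ ++ q ∷ ys₂)
    |C|<|P| = subst (length C <_) (sym (length-++-∷ ys₁ ys₂ q))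
                (s≤s (subst (length C ≤_) (length-map f (ys₁ ++ ys₂)) (Unique-⊆⇒length≤ !C C⊆fP∖q)))

length-cartesianProduct : ∀ (xs : List A) (ys : List B) → length (cartesianProduct xs ys) ≡ length xs * length ys
length-cartesianProduct []       ys = refl
length-cartesianProduct (x ∷ xs) ys =
  trans (length-++ (map (x ,_) ys)) (cong₂ _+_ (length-map (x ,_) ys) (length-cartesianProduct xs ys))

length-filter-¬ : ∀ {P : A → Set} (P? : Decidable P) xs →
                  length (filter P? xs) + length (filter (λ x → ¬? (P? x)) xs) ≡ length xs
length-filter-¬ P? []       = refl
length-filter-¬ P? (x ∷ xs) with P? x
... | yes _ = cong suc (length-filter-¬ P? xs)
... | no  _ = trans (+-suc _ _) (cong suc (length-filter-¬ P? xs))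

length-concatMap : ∀ (f : A → List B) xs → length (concatMap f xs) ≡ sum (map (λ x → length (f x)) xs)
length-concatMap f []       = refl
length-concatMap f (x ∷ xs) = trans (length-++ (f x)) (cong (λ t → length (f x) + t) (length-concatMap f xs))

Unique-concatMap⁺ : ∀ {f : A → List B} (tag : B → A) {xs} → Unique xs → (∀ x → Unique (f x)) →
                    (∀ x {y} → y ∈ f x → tag y ≡ x) → Unique (concatMap f xs)
Unique-concatMap⁺ tag {[]} _ _ _ = []
Unique-concatMap⁺ {f = f} tag {x ∷ xs} (x∉xs ∷ !xs) !f tagged =
  Uniqueₚ.++⁺ (!f x) (Unique-concatMap⁺ tag !xs !f tagged) disjoint
  where
    disjoint : ∀ {v} → ¬ (v ∈ f x × v ∈ concatMap f xs)
    disjoint (v∈fx , v∈rest) with find (∈-concatMap⁻ f v∈rest)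
    ... | x′ , x′∈ , v∈fx′ = All≢⇒∉ x∉xs (subst (_∈ xs) (trans (sym (tagged x′ v∈fx′)) (tagged x v∈fx)) x′∈)

∈-if⁺ : ∀ {P : Set} (P? : Dec P) {xs : List A} {y} → P → y ∈ xs → y ∈ (if does P? then xs else [])
∈-if⁺ (yes _) _ y∈ = y∈
∈-if⁺ (no ¬p) p _  = ⊥-elim (¬p p)

∈-if⁻ : ∀ {P : Set} (P? : Dec P) {xs : List A} {y} → y ∈ (if does P? then xs else []) → P × y ∈ xs
∈-if⁻ (yes p) y∈ = p , y∈

Unique-if : ∀ {P : Set} (P? : Dec P) {xs : List A} → Unique xs → Unique (if does P? then xs else [])
Unique-if (yes _) !xs = !xs
Unique-if (no _)  _   = []

length-if : ∀ {P : Set} (P? : Dec P) {xs : List A} {k} → (P → length xs ≡ k) →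
            length (if does P? then xs else []) ≡ (if does P? then k else 0)
length-if (yes p) |xs| = |xs| p
length-if (no _)  _    = refl

∈-if-else⁻ : ∀ {P : Set} (P? : Dec P) {xs ys : List A} {z} →
             z ∈ (if does P? then xs else ys) → (P × z ∈ xs) ⊎ (¬ P × z ∈ ys)
∈-if-else⁻ (yes p) z∈ = inj₁ (p , z∈)
∈-if-else⁻ (no ¬p) z∈ = inj₂ (¬p , z∈)

∈-if-else⁺ˡ : ∀ {P : Set} (P? : Dec P) {xs ys : List A} {z} → P → z ∈ xs → z ∈ (if does P? then xs else ys)
∈-if-else⁺ˡ (yes _) _ z∈ = z∈
∈-if-else⁺ˡ (no ¬p) p _  = ⊥-elim (¬p p)

∈-if-else⁺ʳ : ∀ {P : Set} (P? : Dec P) {xs ys : List A} {z} → ¬ P → z ∈ ys → z ∈ (if does P? then xs else ys)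
∈-if-else⁺ʳ (yes p) ¬p _ = ⊥-elim (¬p p)
∈-if-else⁺ʳ (no _)  _ z∈ = z∈

bijection⇒length≡ : ∀ {f : A → B} {xs ys} → Unique xs → Unique ys →
                    (∀ {x x′} → x ∈ xs → x′ ∈ xs → f x ≡ f x′ → x ≡ x′) →
                    (∀ {x} → x ∈ xs → f x ∈ ys) → (∀ {y} → y ∈ ys → ∃ λ x → x ∈ xs × f x ≡ y) →
                    length xs ≡ length ys
bijection⇒length≡ {f = f} {xs} {ys} !xs !ys inj into onto =
  trans (sym (length-map f xs)) (Unique-⊆⊇⇒length≡ (Unique-map⁺ !xs inj) !ys fxs⊆ys ys⊆fxs)
  where
    fxs⊆ys : ∀ {y} → y ∈ map f xs → y ∈ ys
    fxs⊆ys y∈ with x , x∈ , refl ← ∈-map⁻ f y∈ = into x∈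
    ys⊆fxs : ∀ {y} → y ∈ ys → y ∈ map f xs
    ys⊆fxs y∈ with x , x∈ , refl ← onto y∈ = ∈-map⁺ f x∈

length-filter-∉ : (_≟_ : DecidableEquality A) → ∀ {xs ys : List A} → Unique xs → Unique ys →
                  (∀ {y} → y ∈ ys → y ∈ xs) → length (filter (λ x → ¬? (Any.any? (x ≟_) ys)) xs) ≡ length xs ∸ length ys
length-filter-∉ _≟_ {xs} {ys} !xs !ys ys⊆xs = begin
  length (filter ∉ys? xs)                                        ≡⟨ m+n∸m≡n (length ys) _ ⟨
  length ys + length (filter ∉ys? xs) ∸ length ys                ≡⟨ cong (λ k → k + length (filter ∉ys? xs) ∸ length ys)
                                                                       |xs∩ys|≡|ys| ⟨
  length (filter ∈ys? xs) + length (filter ∉ys? xs) ∸ length ys  ≡⟨ cong (_∸ length ys) (length-filter-¬ ∈ys? xs) ⟩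
  length xs ∸ length ys                                          ∎
  where
    open ≡-Reasoning
    ∈ys? = λ x → Any.any? (x ≟_) ys
    ∉ys? = λ x → ¬? (∈ys? x)
    |xs∩ys|≡|ys| : length (filter ∈ys? xs) ≡ length ys
    |xs∩ys|≡|ys| = Unique-⊆⊇⇒length≡ (Uniqueₚ.filter⁺ ∈ys? !xs) !ys (λ y∈ → proj₂ (∈-filter⁻ ∈ys? {xs = xs} y∈))
                                     (λ y∈ → ∈-filter⁺ ∈ys? (ys⊆xs y∈) y∈)

Strict-head< : ∀ {x y : ℤ} {xs} → Strict (x ∷ xs) → y ∈ xs → x ℤ.< y
Strict-head< (x<y ∷ _)  (here refl) = x<y
Strict-head< (x<y ∷ ys) (there z∈)  = ℤP.<-trans x<y (Strict-head< ys z∈)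

Strict⇒Unique : ∀ {xs} → Strict xs → Unique xs
Strict⇒Unique s = AllPairs.map ℤP.<⇒≢ (Linkedₚ.Linked⇒AllPairs ℤP.<-trans s)

private
  ∈-∷-≢ : ∀ {x z : ℤ} {xs} → z ∈ x ∷ xs → z ≢ x → z ∈ xs
  ∈-∷-≢ (here refl) z≢x = contradiction refl z≢x
  ∈-∷-≢ (there z∈)  _   = z∈

  tail∉head : ∀ {x z : ℤ} {xs} → Strict (x ∷ xs) → z ∈ xs → z ≢ x
  tail∉head s z∈ refl = ℤP.<-irrefl refl (Strict-head< s z∈)

Strict-≡ : ∀ {xs ys} → Strict xs → Strict ys → (∀ z → z ∈ xs ⇔ z ∈ ys) → xs ≡ ys
Strict-≡ {[]}     {[]}     _  _  _ = refl
Strict-≡ {[]}     {y ∷ ys} _  _  h with () ← from (h y) (here refl)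
Strict-≡ {x ∷ xs} {[]}     _  _  h with () ← to (h x) (here refl)
Strict-≡ {x ∷ xs} {y ∷ ys} sx sy h with x ℤ.≟ y
... | yes refl = cong (x ∷_) (Strict-≡ (Linked.tail sx) (Linked.tail sy) λ z → mk⇔
        (λ z∈ → ∈-∷-≢ (to (h z) (there z∈)) (tail∉head sx z∈))
        (λ z∈ → ∈-∷-≢ (from (h z) (there z∈)) (tail∉head sy z∈)))
... | no x≢y = contradiction (Strict-head< sy x∈ys) (ℤP.<-asym (Strict-head< sx y∈xs))
  where
    x∈ys = ∈-∷-≢ (to (h x) (here refl)) x≢y
    y∈xs = ∈-∷-≢ (from (h y) (here refl)) (x≢y ∘ sym)

-- Tilings of {0, …, n - 1}

module _ (K : ℕ) .{{_ : NonZero K}} where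

  m≡m/K*K+m%K : ∀ m → m ≡ m / K * K + m % K
  m≡m/K*K+m%K m = trans (m≡m%n+[m/n]*n m K) (+-comm (m % K) _)

  [q*K+r]%K≡r : ∀ q {r} → r < K → (q * K + r) % K ≡ r
  [q*K+r]%K≡r q {r} r<K = begin
    (q * K + r) % K ≡⟨ cong (_% K) (+-comm (q * K) r) ⟩
    (r + q * K) % K ≡⟨ [m+kn]%n≡m%n r q K ⟩
    r % K           ≡⟨ m<n⇒m%n≡m r<K ⟩
    r               ∎
    where open ≡-Reasoning

  [q*K+r]/K≡q : ∀ q {r} → r < K → (q * K + r) / K ≡ q
  [q*K+r]/K≡q q {r} r<K = begin
    (q * K + r) / K   ≡⟨ +-distrib-/ (q * K) r
                           (subst₂ (λ a b → a + b < K) (sym (m*n%n≡0 q K)) (sym (m<n⇒m%n≡m r<K)) r<K) ⟩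
    q * K / K + r / K ≡⟨ cong₂ _+_ (m*n/n≡m q K) (m<n⇒m/n≡0 r<K) ⟩
    q + 0             ≡⟨ +-identityʳ q ⟩
    q                 ∎
    where open ≡-Reasoning

  quot-rem-unique : ∀ q q′ {r r′} → r < K → r′ < K → q * K + r ≡ q′ * K + r′ → q ≡ q′ × r ≡ r′
  quot-rem-unique q q′ r<K r′<K e =
    trans (sym ([q*K+r]/K≡q q r<K)) (trans (cong (_/ K) e) ([q*K+r]/K≡q q′ r′<K)) ,
    trans (sym ([q*K+r]%K≡r q r<K)) (trans (cong (_% K) e) ([q*K+r]%K≡r q′ r′<K))

  %≡0⇒m≡m/K*K : ∀ {m} → m % K ≡ 0 → m ≡ m / K * K
  %≡0⇒m≡m/K*K {m} e = trans (m≡m/K*K+m%K m) (trans (cong (m / K * K +_) e) (+-identityʳ _))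

  /K<⇒ : ∀ {m t} → m < t * K → m / K < t
  /K<⇒ {m} {t} m<tK = *-cancelʳ-< K (m / K) t (≤-<-trans (m/n*n≤m m K) m<tK)

record Tiling (n : ℕ) (X Y : ℕ → Set) : Set where
  field
    bounded : ∀ {x y} → X x → Y y → x + y < n
    covers  : ∀ z → z < n → ∃₂ λ x y → X x × Y y × x + y ≡ z
    unique  : ∀ {x y x′ y′} → X x → Y y → X x′ → Y y′ → x + y ≡ x′ + y′ → x ≡ x′

  unique′ : ∀ {x y x′ y′} → X x → Y y → X x′ → Y y′ → x + y ≡ x′ + y′ → y ≡ y′
  unique′ {x} {y} {x′} {y′} Xx Yy Xx′ Yy′ e =
    +-cancelˡ-≡ x y y′ (trans e (cong (_+ y′) (sym (unique Xx Yy Xx′ Yy′ e))))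

  0∈X : 0 < n → X 0
  0∈X 0<n with x , y , Xx , _ , x+y≡0 ← covers 0 0<n = subst X (m+n≡0⇒m≡0 x x+y≡0) Xx

  0∈Y : 0 < n → Y 0
  0∈Y 0<n with x , y , _ , Yy , x+y≡0 ← covers 0 0<n = subst Y (m+n≡0⇒n≡0 x x+y≡0) Yy

  gap∈Y : ∀ {k} → (∀ i → i < k → X i) → k < n → ¬ X k → Y k
  gap∈Y {k} prefix k<n k∉X with x , y , Xx , Yy , x+y≡k ← covers k k<n | y <? k
  ... | yes y<k = contradiction (subst X (trans (sym (+-identityʳ x)) (trans (cong (x +_) (sym y≡0)) x+y≡k)) Xx) k∉X
    where
      y≡0 : y ≡ 0
      y≡0 = sym (unique′ (prefix y y<k) (0∈Y (≤-<-trans z≤n k<n)) (0∈X (≤-<-trans z≤n k<n)) Yy (+-comm y 0))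
  ... | no y≮k = subst Y (≤-antisym (subst (y ≤_) x+y≡k (m≤n+m y x)) (≮⇒≥ y≮k)) Yy

swap : ∀ {n X Y} → Tiling n X Y → Tiling n Y X
swap {n} {X} {Y} T = record
  { bounded = λ {y} {x} Yy Xx → subst (_< n) (+-comm x y) (bounded Xx Yy)
  ; covers  = λ z z<n → let x , y , Xx , Yy , e = covers z z<n in y , x , Yy , Xx , trans (+-comm y x) e
  ; unique  = λ {y} {x} {y′} {x′} Yy Xx Yy′ Xx′ e →
                unique′ Xx Yy Xx′ Yy′ (trans (+-comm x y) (trans e (+-comm y′ x′)))
  }
  where open Tiling T

below : {P : ℕ → Set} → Decidable P → ℕ → List ℕ
below P? n = filter P? (upTo n)

module _ {P : ℕ → Set} (P? : Decidable P) where

  ∈-below⁺ : ∀ {n x} → x < n → P x → x ∈ below P? n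
  ∈-below⁺ x<n Px = ∈-filter⁺ P? (∈-upTo⁺ x<n) Px

  ∈-below⁻ : ∀ {n x} → x ∈ below P? n → x < n × P x
  ∈-below⁻ {n} x∈ with x∈upTo , Px ← ∈-filter⁻ P? {xs = upTo n} x∈ = ∈-upTo⁻ x∈upTo , Px

  Unique-below : ∀ n → Unique (below P? n)
  Unique-below n = Uniqueₚ.filter⁺ P? (Uniqueₚ.upTo⁺ n)

  Linked-below : ∀ n → Linked _<_ (below P? n)
  Linked-below n = Linkedₚ.filter⁺ P? <-trans (Linkedₚ.applyUpTo⁺₁ (λ i → i) n (λ _ → ≤-refl))

below-cong : ∀ {P Q : ℕ → Set} (P? : Decidable P) (Q? : Decidable Q) n →
             (∀ x → x < n → P x ⇔ Q x) → below P? n ≡ below Q? n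
below-cong P? Q? n P⇔Q = go (upTo n) (λ x∈ → ∈-upTo⁻ x∈)
  where
    go : ∀ xs → (∀ {x} → x ∈ xs → x < n) → filter P? xs ≡ filter Q? xs
    go []       _     = refl
    go (x ∷ xs) xs<n with P? x | Q? x
    ... | yes _  | yes _  = cong (x ∷_) (go xs (λ x∈ → xs<n (there x∈)))
    ... | no  _  | no  _  = go xs (λ x∈ → xs<n (there x∈))
    ... | yes Px | no ¬Qx = contradiction (to (P⇔Q x (xs<n (here refl))) Px) ¬Qx
    ... | no ¬Px | yes Qx = contradiction (from (P⇔Q x (xs<n (here refl))) Qx) ¬Px

length-below-≡0 : ∀ {m} → 0 < m → length (below (_≟ 0) m) ≡ 1
length-below-≡0 {m} 0<m = Unique-⊆⊇⇒length≡ (Unique-below (_≟ 0) m) ([] ∷ []) ⊆[0] [0]⊆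
  where
    ⊆[0] : ∀ {z} → z ∈ below (_≟ 0) m → z ∈ 0 ∷ []
    ⊆[0] z∈ with _ , refl ← ∈-below⁻ (_≟ 0) {m} z∈ = here refl
    [0]⊆ : ∀ {z} → z ∈ 0 ∷ [] → z ∈ below (_≟ 0) m
    [0]⊆ (here refl) = ∈-below⁺ (_≟ 0) 0<m refl

module _ {n : ℕ} {X Y : ℕ → Set} (X? : Decidable X) (Y? : Decidable Y) (T : Tiling n X Y) where
  open Tiling T

  -- (x , y) ↦ x + y is a bijection between X × Y and {0, …, n - 1}
  Tiling-size : length (below X? n) * length (below Y? n) ≡ n
  Tiling-size = trans (sym (length-cartesianProduct xs ys))
    (trans (bijection⇒length≡ (Uniqueₚ.cartesianProduct⁺ (Unique-below X? n) (Unique-below Y? n)) (Uniqueₚ.upTo⁺ n)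
                              inj into onto)
           (length-upTo n))
    where
      xs = below X? n
      ys = below Y? n
      inj : ∀ {p p′} → p ∈ cartesianProduct xs ys → p′ ∈ cartesianProduct xs ys →
            uncurry _+_ p ≡ uncurry _+_ p′ → p ≡ p′
      inj p∈ p′∈ e with x∈ , y∈ ← ∈-cartesianProduct⁻ xs ys p∈
                      | x′∈ , y′∈ ← ∈-cartesianProduct⁻ xs ys p′∈ =
        let Xx = proj₂ (∈-below⁻ X? {n} x∈) ; Yy = proj₂ (∈-below⁻ Y? {n} y∈)
            Xx′ = proj₂ (∈-below⁻ X? {n} x′∈) ; Yy′ = proj₂ (∈-below⁻ Y? {n} y′∈)
        in cong₂ _,_ (unique Xx Yy Xx′ Yy′ e) (unique′ Xx Yy Xx′ Yy′ e)
      into : ∀ {p} → p ∈ cartesianProduct xs ys → uncurry _+_ p ∈ upTo n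
      into p∈ with x∈ , y∈ ← ∈-cartesianProduct⁻ xs ys p∈ =
        ∈-upTo⁺ (bounded (proj₂ (∈-below⁻ X? {n} x∈)) (proj₂ (∈-below⁻ Y? {n} y∈)))
      onto : ∀ {z} → z ∈ upTo n → ∃ λ p → p ∈ cartesianProduct xs ys × uncurry _+_ p ≡ z
      onto {z} z∈ with z<n ← ∈-upTo⁻ z∈ | x , y , Xx , Yy , refl ← covers z (∈-upTo⁻ z∈) =
        (x , y) , ∈-cartesianProduct⁺ (∈-below⁺ X? (≤-<-trans (m≤m+n x y) z<n) Xx)
                                      (∈-below⁺ Y? (≤-<-trans (m≤n+m y x) z<n) Yy) , refl

private
  +-*-regroup : ∀ q w K r → q * K + r + w * K ≡ (q + w) * K + r
  +-*-regroup = solve-∀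

-- Blocks K X = K·X + {0, …, K - 1} and Dilate K Y = K·Y
Blocks : (K : ℕ) .{{_ : NonZero K}} → (ℕ → Set) → ℕ → Set
Blocks K X x = X (x / K)

Dilate : (K : ℕ) .{{_ : NonZero K}} → (ℕ → Set) → ℕ → Set
Dilate K Y y = y % K ≡ 0 × Y (y / K)

Blocks? : ∀ K .{{_ : NonZero K}} {X} → Decidable X → Decidable (Blocks K X)
Blocks? K X? x = X? (x / K)

Dilate? : ∀ K .{{_ : NonZero K}} {Y} → Decidable Y → Decidable (Dilate K Y)
Dilate? K Y? y = (y % K ≟ 0) ×-dec Y? (y / K)

Dilate-cong : ∀ K .{{_ : NonZero K}} {P Q : ℕ → Set} → (∀ w → P w ⇔ Q w) → ∀ y → Dilate K P y ⇔ Dilate K Q y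
Dilate-cong K P⇔Q y = mk⇔ (λ (y%K≡0 , Pw) → y%K≡0 , to (P⇔Q (y / K)) Pw)
                          (λ (y%K≡0 , Qw) → y%K≡0 , from (P⇔Q (y / K)) Qw)

module _ (K : ℕ) .{{_ : NonZero K}} where

  sum-decomposition : ∀ {x y} → y % K ≡ 0 → x + y ≡ (x / K + y / K) * K + x % K
  sum-decomposition {x} {y} y%K≡0 = begin
    x + y                          ≡⟨ cong₂ _+_ (m≡m/K*K+m%K K x) (%≡0⇒m≡m/K*K K y%K≡0) ⟩
    x / K * K + x % K + y / K * K  ≡⟨ +-*-regroup (x / K) (y / K) K (x % K) ⟩
    (x / K + y / K) * K + x % K    ∎
    where open ≡-Reasoning

  inflate : ∀ {m X Y} → Tiling m X Y → Tiling (m * K) (Blocks K X) (Dilate K Y)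
  inflate {m} {X} {Y} T = record { bounded = bounded′ ; covers = covers′ ; unique = unique″ }
    where
      open Tiling T
      bounded′ : ∀ {x y} → Blocks K X x → Dilate K Y y → x + y < m * K
      bounded′ {x} {y} Xq (y%K≡0 , Yw) = begin-strict
        x + y                         ≡⟨ sum-decomposition y%K≡0 ⟩
        (x / K + y / K) * K + x % K   <⟨ +-monoʳ-< _ (m%n<n x K) ⟩
        (x / K + y / K) * K + K       ≡⟨ +-comm _ K ⟩
        suc (x / K + y / K) * K       ≤⟨ *-monoˡ-≤ K (bounded Xq Yw) ⟩
        m * K                         ∎
        where open ≤-Reasoning
      covers′ : ∀ z → z < m * K → ∃₂ λ x y → Blocks K X x × Dilate K Y y × x + y ≡ z
      covers′ z z<mK with a , b , Xa , Yb , a+b≡z/K ← covers (z / K) (/K<⇒ K z<mK) =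
        a * K + z % K , b * K ,
        subst X (sym ([q*K+r]/K≡q K a (m%n<n z K))) Xa ,
        (m*n%n≡0 b K , subst Y (sym (m*n/n≡m b K)) Yb) ,
        (begin
          a * K + z % K + b * K   ≡⟨ +-*-regroup a b K (z % K) ⟩
          (a + b) * K + z % K     ≡⟨ cong (λ t → t * K + z % K) a+b≡z/K ⟩
          z / K * K + z % K       ≡⟨ m≡m/K*K+m%K K z ⟨
          z                       ∎)
        where open ≡-Reasoning
      unique″ : ∀ {x y x′ y′} → Blocks K X x → Dilate K Y y → Blocks K X x′ → Dilate K Y y′ → x + y ≡ x′ + y′ → x ≡ x′
      unique″ {x} {y} {x′} {y′} Xx (y%K≡0 , Yy) Xx′ (y′%K≡0 , Yy′) e
        with q≡q′ , r≡r′ ← quot-rem-unique K _ _ (m%n<n x K) (m%n<n x′ K)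
               (trans (sym (sum-decomposition y%K≡0)) (trans e (sum-decomposition y′%K≡0))) =
        trans (m≡m/K*K+m%K K x) (trans (cong₂ (λ a b → a * K + b) (unique Xx Yy Xx′ Yy′ q≡q′) r≡r′)
                                       (sym (m≡m/K*K+m%K K x′)))

  length-below-Blocks : ∀ m {X} (X? : Decidable X) → length (below (Blocks? K X?) (m * K)) ≡ length (below X? m) * K
  length-below-Blocks m {X} X? = trans (sym (bijection⇒length≡ !qr (Unique-below (Blocks? K X?) (m * K)) inj into onto))
    (trans (length-cartesianProduct (below X? m) (upTo K)) (cong (length (below X? m) *_) (length-upTo K)))
    where
      f : ℕ × ℕ → ℕ
      f (q , r) = q * K + r
      qr = cartesianProduct (below X? m) (upTo K)
      !qr = Uniqueₚ.cartesianProduct⁺ (Unique-below X? m) (Uniqueₚ.upTo⁺ K)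
      inj : ∀ {p p′} → p ∈ qr → p′ ∈ qr → f p ≡ f p′ → p ≡ p′
      inj {q , r} {q′ , r′} p∈ p′∈ e
        with _ , r∈ ← ∈-cartesianProduct⁻ (below X? m) (upTo K) p∈
           | _ , r′∈ ← ∈-cartesianProduct⁻ (below X? m) (upTo K) p′∈
        with refl , refl ← quot-rem-unique K q q′ (∈-upTo⁻ r∈) (∈-upTo⁻ r′∈) e = refl
      into : ∀ {p} → p ∈ qr → f p ∈ below (Blocks? K X?) (m * K)
      into {q , r} p∈ with q∈ , r∈ ← ∈-cartesianProduct⁻ (below X? m) (upTo K) p∈
                      with q<m , Xq ← ∈-below⁻ X? {m} q∈ =
        ∈-below⁺ (Blocks? K X?) qK+r<mK (subst X (sym ([q*K+r]/K≡q K q (∈-upTo⁻ r∈))) Xq)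
        where
          qK+r<mK : q * K + r < m * K
          qK+r<mK = <-≤-trans (+-monoʳ-< (q * K) (∈-upTo⁻ r∈)) (subst (_≤ m * K) (+-comm K (q * K)) (*-monoˡ-≤ K q<m))
      onto : ∀ {z} → z ∈ below (Blocks? K X?) (m * K) → ∃ λ p → p ∈ qr × f p ≡ z
      onto {z} z∈ with z<mK , Xq ← ∈-below⁻ (Blocks? K X?) {m * K} z∈ =
        (z / K , z % K) , ∈-cartesianProduct⁺ (∈-below⁺ X? {m} (/K<⇒ K z<mK) Xq) (∈-upTo⁺ (m%n<n z K)) ,
        sym (m≡m/K*K+m%K K z)

  length-below-Dilate : ∀ m {Y} (Y? : Decidable Y) → length (below (Dilate? K Y?) (m * K)) ≡ length (below Y? m)
  length-below-Dilate m {Y} Y? = sym (bijection⇒length≡ (Unique-below Y? m) (Unique-below (Dilate? K Y?) (m * K))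
                                                          (λ _ _ → *-cancelʳ-≡ _ _ K) into onto)
    where
      into : ∀ {w} → w ∈ below Y? m → w * K ∈ below (Dilate? K Y?) (m * K)
      into {w} w∈ with w<m , Yw ← ∈-below⁻ Y? {m} w∈ =
        ∈-below⁺ (Dilate? K Y?) {m * K} (*-monoˡ-< K w<m) (m*n%n≡0 w K , subst Y (sym (m*n/n≡m w K)) Yw)
      onto : ∀ {z} → z ∈ below (Dilate? K Y?) (m * K) → ∃ λ w → w ∈ below Y? m × w * K ≡ z
      onto {z} z∈ with z<mK , (z%K≡0 , Yw) ← ∈-below⁻ (Dilate? K Y?) {m * K} z∈ =
        z / K , ∈-below⁺ Y? {m} (*-cancelʳ-< K _ m (subst (_< m * K) (%≡0⇒m≡m/K*K K z%K≡0) z<mK)) Yw ,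
        sym (%≡0⇒m≡m/K*K K z%K≡0)

-- de Bruijn's structure theorem: if the initial run of X is {0, …, K - 1}, then K ∣ n and the
-- tiling is the K-fold inflation of a tiling of {0, …, n / K - 1}.
module Contraction {n K : ℕ} .{{_ : NonZero K}} {X Y : ℕ → Set} (T : Tiling n X Y)
  (prefix : ∀ i → i < K → X i) (0∈Y : Y 0) (K∈Y : K < n → Y K) where

  open Tiling T using (bounded; covers; unique; unique′)

  private
    0<K : 0 < K
    0<K = >-nonZero⁻¹ K

    0∈X : X 0
    0∈X = prefix 0 0<K

  -- By strong induction on t, each tK < n is start + shift·K with shift·K ∈ Y and a whole block
  -- {start, …, start + K - 1} ⊆ X.
  record FullBlock (t : ℕ) : Set where
    field
      start shift : ℕ
      shift∈Y     : Y (shift * K)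
      decomposes  : start + shift * K ≡ t * K
      block⊆X     : ∀ i → i < K → X (start + i)

  FullBlock-split : ∀ {t r x y} (b : FullBlock t) → r < K → X x → Y y → x + y ≡ t * K + r →
                    x ≡ FullBlock.start b + r × y ≡ FullBlock.shift b * K
  FullBlock-split {t} {r} {x} {y} b r<K Xx Yy e = unique Xx Yy Xsr shift∈Y e′ , unique′ Xx Yy Xsr shift∈Y e′
    where
      open FullBlock b
      Xsr = block⊆X r r<K
      e′ : x + y ≡ (start + r) + shift * K
      e′ = trans e (trans (cong (_+ r) (sym decomposes)) (xy∙z≈xz∙y start _ r))

  block-of : ∀ {q r x} → FullBlock q → r < K → X x → x ≡ q * K + r → ∀ i → i < K → X (q * K + i)
  block-of {q} {r} {x} b r<K Xx x≡ i i<K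
    with _ , 0≡shiftK ← FullBlock-split b r<K Xx 0∈Y (trans (+-identityʳ x) x≡) =
    subst (λ s → X (s + i)) start≡qK (block⊆X i i<K)
    where
      open FullBlock b
      start≡qK : start ≡ q * K
      start≡qK = trans (sym (+-identityʳ start))
                   (trans (cong (λ s → start + s * K) (sym (*-cancelʳ-≡ shift 0 K (sym 0≡shiftK)))) decomposes)

  Below : ℕ → Set
  Below t = ∀ {t′} → t′ < t → t′ * K < n → FullBlock t′

  Y-multiple-below : ∀ {t y} → Below t → t * K < n → Y y → y < t * K → ∃ λ w → y ≡ w * K × w < t
  Y-multiple-below {t} {y} below tK<n Yy y<tK = shift , y≡wK , *-cancelʳ-< K shift t (subst (_< t * K) y≡wK y<tK)
    where
      b = below (/K<⇒ K y<tK) (≤-<-trans (m/n*n≤m y K) (<-trans y<tK tK<n))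
      open FullBlock b
      y≡wK = proj₂ (FullBlock-split b (m%n<n y K) 0∈X Yy (m≡m/K*K+m%K K y))

  X-block-below : ∀ {t x} → Below t → t * K < n → X x → x < t * K → x / K < t × (∀ i → i < K → X (x / K * K + i))
  X-block-below {t} {x} below tK<n Xx x<tK = q<t , block-of b (m%n<n x K) Xx (m≡m/K*K+m%K K x)
    where
      q<t = /K<⇒ K x<tK
      b = below q<t (≤-<-trans (m/n*n≤m x K) (<-trans x<tK tK<n))

  -- tK + i = x + y with 0 < y < tK is impossible: then y = wK, x = qK + r, forcing q + w = t and
  -- a second representation qK + wK = tK + 0
  cover-low : ∀ {t i x y} → Below t → t * K < n → X (t * K) → i < K →
              X x → Y y → x + y ≡ t * K + i → y ≢ 0 → y < t * K → ⊥
  cover-low {t} {i} {x} {y} below tK<n XtK i<K Xx Yy e y≢0 y<tK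
    with w , y≡wK , _ ← Y-multiple-below below tK<n Yy y<tK =
    y≢0 (trans y≡wK (cong (_* K) w≡0))
    where
      K≤y : K ≤ y
      K≤y = subst (K ≤_) (sym y≡wK) (m≤n*m K w ⦃ ≢-nonZero (λ w≡0 → y≢0 (trans y≡wK (cong (_* K) w≡0))) ⦄)
      x<tK : x < t * K
      x<tK = +-cancelʳ-< K x (t * K) (≤-<-trans (+-monoʳ-≤ x K≤y) (subst (_< t * K + K) (sym e) (+-monoʳ-< (t * K) i<K)))
      q = x / K
      Xblock = proj₂ (X-block-below below tK<n Xx x<tK)
      XqK : X (q * K)
      XqK = subst X (+-identityʳ _) (Xblock 0 0<K)
      q+w≡t : q + w ≡ t
      q+w≡t = proj₁ (quot-rem-unique K (q + w) t (m%n<n x K) i<K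
                (trans (sym (+-*-regroup q w K (x % K))) (trans (cong₂ _+_ (sym (m≡m/K*K+m%K K x)) (sym y≡wK)) e)))
      w≡0 : w ≡ 0
      w≡0 = *-cancelʳ-≡ w 0 K (unique′ XqK (subst Y y≡wK Yy) XtK 0∈Y
              (trans (sym (*-distribʳ-+ K q w)) (trans (cong (_* K) q+w≡t) (sym (+-identityʳ _)))))

  -- tK + i = x + y with tK ≤ y, y ≠ 0 is impossible (t ≥ 1): writing y = tK + r, either tK + r ∈ X
  -- already, or r = i > 0 and then tK + K = (K - i) + y is a second representation
  cover-high : ∀ {t i x y} → K ≤ t * K → t * K < n → X (t * K) → i < K → (∀ j → j < i → X (t * K + j)) →
               X x → Y y → x + y ≡ t * K + i → y ≢ 0 → t * K ≤ y → ⊥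
  cover-high {t} {i} {x} {y} K≤tK tK<n XtK i<K prev Xx Yy e y≢0 tK≤y = cases (r ≟ 0) (m≤n⇒m<n∨m≡n r≤i)
    where
      r = y ∸ t * K
      y≡tK+r : y ≡ t * K + r
      y≡tK+r = sym (m+[n∸m]≡n tK≤y)
      x+r≡i : x + r ≡ i
      x+r≡i = +-cancelˡ-≡ (t * K) _ _ (trans (sym (x∙yz≈y∙xz x (t * K) r)) (trans (cong (x +_) (sym y≡tK+r)) e))
      r≤i : r ≤ i
      r≤i = subst (r ≤_) x+r≡i (m≤n+m r x)
      tK+r∉X : ¬ X (t * K + r)
      tK+r∉X XtK+r = y≢0 (sym (unique′ XtK+r 0∈Y 0∈X Yy (trans (+-identityʳ _) (sym y≡tK+r))))
      cases : Dec (r ≡ 0) → r < i ⊎ r ≡ i → ⊥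
      cases (yes r≡0) _          = tK+r∉X (subst (λ s → X (t * K + s)) (sym r≡0) (subst X (sym (+-identityʳ _)) XtK))
      cases (no _)    (inj₁ r<i) = tK+r∉X (prev r r<i)
      cases (no r≢0)  (inj₂ r≡i) = <⇒≱ (<-≤-trans d<K K≤tK) (≤-reflexive tK≡d)
        where
          r<K = subst (_< K) (sym r≡i) i<K
          d = K ∸ r
          d<K : d < K
          d<K = ∸-monoʳ-< (n≢0⇒n>0 r≢0) (<⇒≤ r<K)
          tK+K≡d+y : t * K + K ≡ d + y
          tK+K≡d+y = begin
            t * K + K        ≡⟨ cong (t * K +_) (sym (m+[n∸m]≡n (<⇒≤ r<K))) ⟩
            t * K + (r + d)  ≡⟨ x∙yz≈z∙xy (t * K) r d ⟩
            d + (t * K + r)  ≡⟨ cong (d +_) (sym y≡tK+r) ⟩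
            d + y            ∎
            where open ≡-Reasoning
          tK≡d : t * K ≡ d
          tK≡d = unique XtK (K∈Y (≤-<-trans K≤tK tK<n)) (prefix d d<K) Yy tK+K≡d+y

  private
    K≤[1+t]K : ∀ t → K ≤ suc t * K
    K≤[1+t]K t = m≤m+n K (t * K)

    tK+i<n : ∀ {t i} → X (suc t * K) → suc t * K < n → i < K → suc t * K + i < n
    tK+i<n {t} XtK tK<n i<K = <-trans (+-monoʳ-< _ i<K) (bounded XtK (K∈Y (≤-<-trans (K≤[1+t]K t) tK<n)))

  fill : ∀ t → Below t → t * K < n → X (t * K) → ∀ i → i < K → (∀ j → j < i → X (t * K + j)) → X (t * K + i)
  fill zero    _     _    _   i i<K _ = prefix i i<K
  fill (suc t) below tK<n XtK i i<K prev
    with x , y , Xx , Yy , e ← covers (suc t * K + i) (tK+i<n {t} XtK tK<n i<K) | y ≟ 0 | y <? suc t * K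
  ... | yes refl | _        = subst X (trans (sym (+-identityʳ x)) e) Xx
  ... | no y≢0   | yes y<tK = ⊥-elim (cover-low {suc t} below tK<n XtK i<K Xx Yy e y≢0 y<tK)
  ... | no y≢0   | no y≮tK  = ⊥-elim (cover-high {suc t} (K≤[1+t]K t) tK<n XtK i<K prev Xx Yy e y≢0 (≮⇒≥ y≮tK))

  fill-all : ∀ t → Below t → t * K < n → X (t * K) → ∀ i → i ≤ K → ∀ j → j < i → X (t * K + j)
  fill-all t below tK<n XtK (suc i) 1+i≤K j j<1+i with m<1+n⇒m<n∨m≡n j<1+i
  ... | inj₁ j<i  = fill-all t below tK<n XtK i (<⇒≤ 1+i≤K) j j<i
  ... | inj₂ refl = fill t below tK<n XtK j 1+i≤K (fill-all t below tK<n XtK j (<⇒≤ 1+i≤K))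

  next-block : ∀ t → Below t → t * K < n → FullBlock t
  next-block t below tK<n with x , y , Xx , Yy , e ← covers (t * K) tK<n | y ≟ 0 | y <? t * K
  ... | yes refl | _ = record
    { start = t * K ; shift = 0 ; shift∈Y = 0∈Y ; decomposes = +-identityʳ _
    ; block⊆X = fill-all t below tK<n (subst X (trans (sym (+-identityʳ x)) e) Xx) K ≤-refl }
  ... | no y≢0 | yes y<tK = record
    { start = x / K * K ; shift = w ; shift∈Y = subst Y y≡wK Yy
    ; decomposes = trans (sym (*-distribʳ-+ K (x / K) w)) (cong (_* K) q+w≡t)
    ; block⊆X = proj₂ (X-block-below below tK<n Xx x<tK) }
    where
      w = proj₁ (Y-multiple-below below tK<n Yy y<tK)
      y≡wK = proj₁ (proj₂ (Y-multiple-below below tK<n Yy y<tK))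
      x<tK : x < t * K
      x<tK = subst (x <_) e (m<m+n x (n≢0⇒n>0 y≢0))
      q+w≡t : x / K + w ≡ t
      q+w≡t = proj₁ (quot-rem-unique K (x / K + w) t (m%n<n x K) 0<K
                (trans (sym (+-*-regroup (x / K) w K (x % K)))
                  (trans (cong₂ _+_ (sym (m≡m/K*K+m%K K x)) (sym y≡wK)) (trans e (sym (+-identityʳ _))))))
  ... | no y≢0 | no y≮tK = record
    { start = 0 ; shift = t ; shift∈Y = subst Y y≡tK Yy ; decomposes = refl ; block⊆X = prefix }
    where
      y≡tK : y ≡ t * K
      y≡tK = ≤-antisym (subst (y ≤_) e (m≤n+m y x)) (≮⇒≥ y≮tK)

  full-block : ∀ t → t * K < n → FullBlock t
  full-block = <-rec (λ t → t * K < n → FullBlock t) next-block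

  private
    block-at : ∀ {x} → X x → FullBlock (x / K)
    block-at {x} Xx = full-block (x / K) (≤-<-trans (m/n*n≤m x K) (subst (_< n) (+-identityʳ x) (bounded Xx 0∈Y)))

  Y⇒multiple : ∀ {y} → Y y → y ≡ y / K * K
  Y⇒multiple {y} Yy = trans y≡wK (cong (_* K) (sym (trans (cong (_/ K) y≡wK) (m*n/n≡m shift K))))
    where
      b = full-block (y / K) (≤-<-trans (m/n*n≤m y K) (bounded 0∈X Yy))
      open FullBlock b
      y≡wK = proj₂ (FullBlock-split b (m%n<n y K) 0∈X Yy (m≡m/K*K+m%K K y))

  X-block : ∀ {x} → X x → ∀ i → i < K → X (x / K * K + i)
  X-block {x} Xx = block-of (block-at Xx) (m%n<n x K) Xx (m≡m/K*K+m%K K x)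

  X⇔Blocks : ∀ x → X x ⇔ Blocks K (λ q → X (q * K)) x
  X⇔Blocks x = mk⇔ (λ Xx → subst X (+-identityʳ _) (X-block Xx 0 0<K))
                   (λ XqK → subst X (sym (m≡m/K*K+m%K K x))
                              (subst (λ q → X (q * K + x % K)) (m*n/n≡m (x / K) K) (X-block XqK (x % K) (m%n<n x K))))

  Y⇔Dilate : ∀ y → Y y ⇔ Dilate K (λ w → Y (w * K)) y
  Y⇔Dilate y = mk⇔ (λ Yy → trans (cong (_% K) (Y⇒multiple Yy)) (m*n%n≡0 (y / K) K) , subst Y (Y⇒multiple Yy) Yy)
                   (λ (y%K≡0 , Yw) → subst Y (sym (%≡0⇒m≡m/K*K K y%K≡0)) Yw)

  n≡n/K*K : n ≡ n / K * K
  n≡n/K*K with n % K ≟ 0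
  ... | yes n%K≡0 = %≡0⇒m≡m/K*K K n%K≡0
  ... | no n%K≢0  = ⊥-elim (<-irrefl start+r+wK≡n (bounded (block⊆X r (m%n<n n K)) shift∈Y))
    where
      r = n % K
      tK<n : n / K * K < n
      tK<n = subst (n / K * K <_) (sym (m≡m/K*K+m%K K n)) (m<m+n _ (n≢0⇒n>0 n%K≢0))
      open FullBlock (full-block (n / K) tK<n)
      start+r+wK≡n : start + r + shift * K ≡ n
      start+r+wK≡n = trans (xy∙z≈xz∙y start r _) (trans (cong (_+ r) decomposes) (sym (m≡m/K*K+m%K K n)))

  contract : ∀ m → n ≡ m * K → Tiling m (λ q → X (q * K)) (λ w → Y (w * K))
  contract m n≡mK = record
    { bounded = λ {q} {w} → bounded′ {q} {w}
    ; covers  = covers′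
    ; unique  = λ {q} {w} {q′} {w′} → unique″ {q} {w} {q′} {w′}
    }
    where
      bounded′ : ∀ {q w} → X (q * K) → Y (w * K) → q + w < m
      bounded′ {q} {w} XqK YwK = *-cancelʳ-< K (q + w) m (subst₂ _<_ (sym (*-distribʳ-+ K q w)) n≡mK (bounded XqK YwK))
      covers′ : ∀ z → z < m → ∃₂ λ q w → X (q * K) × Y (w * K) × q + w ≡ z
      covers′ z z<m with x , y , Xx , Yy , x+y≡zK ← covers (z * K) (subst (z * K <_) (sym n≡mK) (*-monoˡ-< K z<m)) =
        x / K , y / K , to (X⇔Blocks x) Xx , subst Y (Y⇒multiple Yy) Yy ,
        proj₁ (quot-rem-unique K (x / K + y / K) z (m%n<n x K) 0<K
          (trans (sym (sum-decomposition K (proj₁ (to (Y⇔Dilate y) Yy)))) (trans x+y≡zK (sym (+-identityʳ _)))))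
      unique″ : ∀ {q w q′ w′} → X (q * K) → Y (w * K) → X (q′ * K) → Y (w′ * K) → q + w ≡ q′ + w′ → q ≡ q′
      unique″ {q} {w} {q′} {w′} XqK YwK Xq′K Yw′K e = *-cancelʳ-≡ q q′ K (unique XqK YwK Xq′K Yw′K
        (trans (sym (*-distribʳ-+ K q w)) (trans (cong (_* K) e) (*-distribʳ-+ K q′ w′))))

initial-run : ∀ {P : ℕ → Set} → Decidable P → ∀ N → ∃ λ k → k ≤ N × (∀ i → i < k → P i) × (k < N → ¬ P k)
initial-run P? zero = 0 , z≤n , (λ _ ()) , (λ ())
initial-run P? (suc N) with k , k≤N , run , stop ← initial-run P? N | m≤n⇒m<n∨m≡n k≤N
... | inj₁ k<N = k , m≤n⇒m≤1+n k≤N , run , (λ _ → stop k<N)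
... | inj₂ refl with P? k
...   | no ¬Pk = k , n≤1+n k , run , (λ _ → ¬Pk)
...   | yes Pk = suc k , ≤-refl , run′ , (λ k<k → ⊥-elim (<-irrefl refl k<k))
  where
    run′ : ∀ i → i < suc k → _
    run′ i i<1+k with m<1+n⇒m<n∨m≡n i<1+k
    ... | inj₁ i<k  = run i i<k
    ... | inj₂ refl = Pk

-- Every tiling arises in one of two ways, K ≥ 1 being the length of the initial run of X:
-- X = {0, …, K - 1} with Y = K·{0, …, m - 1}, or, for some J ≥ 2, X and Y are obtained from a
-- tiling (X′ , Y′) of {0, …, m - 1} with 1 ∈ X′ by a J-fold and then a K-fold inflation, the
-- roles of the two sides swapped in between.
data Shape (n : ℕ) (X Y : ℕ → Set) : Set₁ where
  interval-shape : ∀ k m → n ≡ m * suc k →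
                   (∀ x → X x ⇔ x / suc k ≡ 0) → (∀ y → Y y ⇔ Dilate (suc k) (_< m) y) → Shape n X Y
  nested-shape   : ∀ k j m {X′ Y′} → Decidable X′ → Decidable Y′ → n ≡ m * suc (suc j) * suc k →
                   Tiling m X′ Y′ → X′ 1 →
                   (∀ x → X x ⇔ Blocks (suc k) (Dilate (suc (suc j)) X′) x) →
                   (∀ y → Y y ⇔ Dilate (suc k) (Blocks (suc (suc j)) Y′) y) → Shape n X Y

classify : ∀ {n X Y} → Decidable X → Decidable Y → Tiling n X Y → 0 < n → Shape n X Y
classify {n} {X} {Y} X? Y? T 0<n with initial-run X? n
... | zero  , _ , _   , stop = ⊥-elim (stop 0<n (Tiling.0∈X T 0<n))
... | suc k , _ , run , stop = second-run (initial-run (λ w → Y? (w * K)) m₁)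
  where
    K = suc k
    open Tiling T using (0∈Y; gap∈Y)
    module C₁ = Contraction T run (0∈Y 0<n) (λ K<n → gap∈Y run K<n (stop K<n))
    m₁ = n / K
    X₁ Y₁ : ℕ → Set
    X₁ q = X (q * K)
    Y₁ w = Y (w * K)
    T₁ : Tiling m₁ X₁ Y₁
    T₁ = C₁.contract m₁ C₁.n≡n/K*K
    X₁0 : X₁ 0
    X₁0 = run 0 (s≤s z≤n)
    0<m₁ : 0 < m₁
    0<m₁ = ≤-<-trans z≤n (Tiling.bounded T₁ {0} {0} X₁0 (0∈Y 0<n))
    gap₁∈X₁ : ∀ {J} → (∀ i → i < J → Y₁ i) → (J < m₁ → ¬ Y₁ J) → J < m₁ → X₁ J
    gap₁∈X₁ run₁ stop₁ J<m₁ = Tiling.gap∈Y (swap T₁) run₁ J<m₁ (stop₁ J<m₁)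
    nested : ∀ j → suc j < m₁ → (∀ i → i < suc j → Y₁ i) → (suc j < m₁ → ¬ Y₁ (suc j)) → Shape n X Y
    nested zero 1<m₁ run₁ stop₁ = ⊥-elim (stop K<n (subst X (+-identityʳ K) (gap₁∈X₁ run₁ stop₁ 1<m₁)))
      where
        K<n : K < n
        K<n = subst₂ _<_ (*-identityˡ K) (sym C₁.n≡n/K*K) (*-monoˡ-< K 1<m₁)
    nested (suc j) J<m₁ run₁ stop₁ = nested-shape k j m (λ w → X? (w * J * K)) (λ q → Y? (q * J * K))
        (trans C₁.n≡n/K*K (cong (_* K) C₂.n≡n/K*K)) (swap (C₂.contract m C₂.n≡n/K*K)) X₂1
        (λ x → ⇔.trans (C₁.X⇔Blocks x) (C₂.Y⇔Dilate (x / K)))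
        (λ y → ⇔.trans (C₁.Y⇔Dilate y) (Dilate-cong K C₂.X⇔Blocks y))
      where
        J = suc (suc j)
        module C₂ = Contraction (swap T₁) run₁ X₁0 (gap₁∈X₁ run₁ stop₁)
        m = m₁ / J
        X₂1 : X (1 * J * K)
        X₂1 = subst (λ z → X (z * K)) (sym (+-identityʳ J)) (gap₁∈X₁ run₁ stop₁ J<m₁)
    second-run : (∃ λ j → j ≤ m₁ × (∀ i → i < j → Y₁ i) × (j < m₁ → ¬ Y₁ j)) → Shape n X Y
    second-run (zero , _ , _ , stop₁) = ⊥-elim (stop₁ 0<m₁ (0∈Y 0<n))
    second-run (suc j , J≤m₁ , run₁ , stop₁) with m≤n⇒m<n∨m≡n J≤m₁
    ... | inj₂ J≡m₁ = interval-shape k m₁ C₁.n≡n/K*K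
          (λ x → ⇔.trans (C₁.X⇔Blocks x) X₁⇔≡0) (λ y → ⇔.trans (C₁.Y⇔Dilate y) (Dilate-cong K Y₁⇔<m₁ y))
      where
        Y₁⇔<m₁ : ∀ w → Y₁ w ⇔ w < m₁
        Y₁⇔<m₁ w = mk⇔ (Tiling.bounded T₁ {0} {w} X₁0) (λ w<m₁ → run₁ w (subst (w <_) (sym J≡m₁) w<m₁))
        X₁⇔≡0 : ∀ {q} → X₁ q ⇔ q ≡ 0
        -- q ∈ X₁ lies in the run {0, …, m₁ - 1} ⊆ Y₁, so q + 0 = 0 + q forces q = 0
        X₁⇔≡0 {q} = mk⇔ (λ X₁q → Tiling.unique T₁ {q} {0} {0} {q} X₁q (0∈Y 0<n) X₁0
                                   (from (Y₁⇔<m₁ q) (subst (_< m₁) (+-identityʳ q) (Tiling.bounded T₁ {q} {0} X₁q (0∈Y 0<n))))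
                                   (+-comm q 0))
                         (λ { refl → X₁0 })
    ... | inj₁ J<m₁ = nested j J<m₁ run₁ stop₁

-- Pairs in 𝒯 as tilings

-- imported only now: earlier, + x would make the ℕ sections (x +_) above ambiguous
open import Data.Integer using (+_)

-- A ⊆ [1, n] is encoded by X = A - 1 ⊆ [0, n), B ⊆ [0, n) by itself.
encodeA : {P : ℕ → Set} → Decidable P → ℕ → List ℤ
encodeA P? n = map (λ x → + suc x) (below P? n)

encodeB : {P : ℕ → Set} → Decidable P → ℕ → List ℤ
encodeB P? n = map (λ y → + y) (below P? n)

+suc-injective : ∀ {a b} → + suc a ≡ + suc b → a ≡ b
+suc-injective e = suc-injective (ℤP.+-injective e)

module _ {P : ℕ → Set} (P? : Decidable P) where

  Strict-encodeA : ∀ n → Strict (encodeA P? n)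
  Strict-encodeA n = Linkedₚ.map⁺ (Linked.map (λ x<y → ℤ.+<+ (s≤s x<y)) (Linked-below P? n))

  Strict-encodeB : ∀ n → Strict (encodeB P? n)
  Strict-encodeB n = Linkedₚ.map⁺ (Linked.map ℤ.+<+ (Linked-below P? n))

  ∈-encodeA⁺ : ∀ {n x} → x < n → P x → + suc x ∈ encodeA P? n
  ∈-encodeA⁺ x<n Px = ∈-map⁺ (λ x → + suc x) (∈-below⁺ P? x<n Px)

  ∈-encodeA⁻ : ∀ {n z} → z ∈ encodeA P? n → ∃ λ x → z ≡ + suc x × x < n × P x
  ∈-encodeA⁻ {n} z∈ with x , x∈ , refl ← ∈-map⁻ (λ x → + suc x) z∈ = x , refl , ∈-below⁻ P? {n} x∈

  ∈-encodeB⁺ : ∀ {n x} → x < n → P x → + x ∈ encodeB P? n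
  ∈-encodeB⁺ x<n Px = ∈-map⁺ (λ y → + y) (∈-below⁺ P? x<n Px)

  ∈-encodeB⁻ : ∀ {n z} → z ∈ encodeB P? n → ∃ λ x → z ≡ + x × x < n × P x
  ∈-encodeB⁻ {n} z∈ with x , x∈ , refl ← ∈-map⁻ (λ y → + y) z∈ = x , refl , ∈-below⁻ P? {n} x∈

module _ {P Q : ℕ → Set} (P? : Decidable P) (Q? : Decidable Q) {n : ℕ} where

  encodeA-≡⇒ : encodeA P? n ≡ encodeA Q? n → ∀ {x} → x < n → P x → Q x
  encodeA-≡⇒ e x<n Px with x′ , e′ , _ , Qx′ ← ∈-encodeA⁻ Q? {n} (subst (_ ∈_) e (∈-encodeA⁺ P? x<n Px)) =
    subst Q (sym (+suc-injective e′)) Qx′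

  encodeB-≡⇒ : encodeB P? n ≡ encodeB Q? n → ∀ {x} → x < n → P x → Q x
  encodeB-≡⇒ e x<n Px with x′ , e′ , _ , Qx′ ← ∈-encodeB⁻ Q? {n} (subst (_ ∈_) e (∈-encodeB⁺ P? x<n Px)) =
    subst Q (sym (ℤP.+-injective e′)) Qx′

∈-interval⁺ : ∀ {n i} → i < n → + suc i ∈ interval n
∈-interval⁺ i<n = ∈-map⁺ (λ i → + suc i) (∈-upTo⁺ i<n)

∈-interval⁻ : ∀ {n z} → z ∈ interval n → ∃ λ i → z ≡ + suc i × i < n
∈-interval⁻ z∈ with i , i∈ , refl ← ∈-map⁻ (λ i → + suc i) z∈ = i , refl , ∈-upTo⁻ i∈

length-interval : ∀ n → length (interval n) ≡ n
length-interval n = trans (length-map _ (upTo n)) (length-upTo n)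

Unique-interval : ∀ n → Unique (interval n)
Unique-interval n = Uniqueₚ.map⁺ +suc-injective (Uniqueₚ.upTo⁺ n)

tiling⇒𝒯 : ∀ {n X Y} (X? : Decidable X) (Y? : Decidable Y) → Tiling n X Y → 0 < n →
           𝒯 (length (below X? n)) (interval n) (encodeA X? n , encodeB Y? n)
tiling⇒𝒯 {n} {X} {Y} X? Y? T 0<n =
  Strict-encodeA X? n , Strict-encodeB Y? n , (λ z → mk⇔ (sum-of z) (in-interval z)) , size ,
  length-map _ (below X? n) , ∈-encodeB⁺ Y? 0<n (0∈Y 0<n) , All.tabulate nonneg
  where
    open Tiling T
    sum-of : ∀ z → z ∈ interval n → ∃ λ a → ∃ λ b → a ∈ encodeA X? n × b ∈ encodeB Y? n × z ≡ a ℤ.+ b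
    sum-of z z∈ with i , refl , i<n ← ∈-interval⁻ z∈ with x , y , Xx , Yy , refl ← covers i i<n =
      + suc x , + y , ∈-encodeA⁺ X? (≤-<-trans (m≤m+n x y) i<n) Xx , ∈-encodeB⁺ Y? (≤-<-trans (m≤n+m y x) i<n) Yy , refl
    in-interval : ∀ z → (∃ λ a → ∃ λ b → a ∈ encodeA X? n × b ∈ encodeB Y? n × z ≡ a ℤ.+ b) → z ∈ interval n
    in-interval z (a , b , a∈ , b∈ , refl) with x , refl , _ , Xx ← ∈-encodeA⁻ X? {n} a∈
                                              | y , refl , _ , Yy ← ∈-encodeB⁻ Y? {n} b∈ =
      ∈-interval⁺ (bounded Xx Yy)
    size : length (interval n) ≡ length (encodeA X? n) * length (encodeB Y? n)
    size = trans (length-interval n) (trans (sym (Tiling-size X? Y? T))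
             (sym (cong₂ _*_ (length-map _ (below X? n)) (length-map _ (below Y? n)))))
    nonneg : ∀ {b} → b ∈ encodeB Y? n → + 0 ℤ.≤ b
    nonneg b∈ with _ , refl , _ ← ∈-encodeB⁻ Y? {n} b∈ = ℤ.+≤+ z≤n

InA InB : List ℤ → ℕ → Set
InA A x = + suc x ∈ A
InB B y = + y ∈ B

InA? : (A : List ℤ) → Decidable (InA A)
InA? A x = + suc x ∈? A

InB? : (B : List ℤ) → Decidable (InB B)
InB? B y = + y ∈? B

record Decoded (n : ℕ) (A B : List ℤ) : Set where
  field
    tiling : Tiling n (InA A) (InB B)
    A≡     : A ≡ encodeA (InA? A) n
    B≡     : B ≡ encodeB (InB? B) n

𝒯⇒Decoded : ∀ {α n A B} → 𝒯 α (interval n) (A , B) → 0 < n → Decoded n A B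
𝒯⇒Decoded {α} {n} {A} {B} (sA , sB , A+B≡C , |C|≡|A||B| , _ , 0∈B , B≥0) 0<n =
  record { tiling = T ; A≡ = Strict-≡ sA (Strict-encodeA (InA? A) n) (λ z → mk⇔ A⊆ (A⊇ z))
                      ; B≡ = Strict-≡ sB (Strict-encodeB (InB? B) n) (λ z → mk⇔ B⊆ (B⊇ z)) }
  where
    sum∈ : ∀ {a b} → a ∈ A → b ∈ B → a ℤ.+ b ∈ interval n
    sum∈ {a} {b} a∈ b∈ = from (A+B≡C (a ℤ.+ b)) (a , b , a∈ , b∈ , refl)
    sum∈⁻ : ∀ {x y} → InA A x → InB B y → x + y < n
    sum∈⁻ a∈ b∈ with _ , e , i<n ← ∈-interval⁻ (sum∈ a∈ b∈) = subst (_< n) (sym (+suc-injective e)) i<n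
    A-elem : ∀ {a} → a ∈ A → ∃ λ x → a ≡ + suc x × x < n
    A-elem {a} a∈ with i , e , i<n ← ∈-interval⁻ (sum∈ a∈ 0∈B) = i , trans (sym (ℤP.+-identityʳ a)) e , i<n
    a₀∈A : ∃ λ x → InA A x
    a₀∈A with a , _ , a∈ , _ ← to (A+B≡C (+ 1)) (∈-interval⁺ 0<n) with x , refl , _ ← A-elem a∈ = x , a∈
    B-elem : ∀ {b} → b ∈ B → ∃ λ y → b ≡ + y × y < n
    B-elem b∈ with All.lookup B≥0 b∈ | a₀∈A
    ... | ℤ.+≤+ {n = y} _ | x , a∈ = y , refl , ≤-<-trans (m≤n+m y x) (sum∈⁻ a∈ b∈)
    covers : ∀ z → z < n → ∃ λ x → ∃ λ y → InA A x × InB B y × x + y ≡ z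
    covers z z<n with a , b , a∈ , b∈ , e ← to (A+B≡C (+ suc z)) (∈-interval⁺ z<n)
                 with x , refl , _ ← A-elem a∈ | y , refl , _ ← B-elem b∈ = x , y , a∈ , b∈ , sym (+suc-injective e)
    -- |A × B| = |[n]| and A × B → [n] is onto, so it is injective
    unique : ∀ {x y x′ y′} → InA A x → InB B y → InA A x′ → InB B y′ → x + y ≡ x′ + y′ → x ≡ x′
    unique a∈ b∈ a′∈ b′∈ e = +suc-injective (cong proj₁
      (pigeonhole (×P.≡-dec ℤ._≟_ ℤ._≟_) (uncurry ℤ._+_) (Unique-interval n)
        (≤-reflexive (trans (length-cartesianProduct A B) (sym |C|≡|A||B|))) onto
        (∈-cartesianProduct⁺ a∈ b∈) (∈-cartesianProduct⁺ a′∈ b′∈) (cong (λ t → + suc t) e)))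
      where
        onto : ∀ {c} → c ∈ interval n → c ∈ map (uncurry ℤ._+_) (cartesianProduct A B)
        onto c∈ with a , b , a∈ , b∈ , refl ← to (A+B≡C _) c∈ = ∈-map⁺ (uncurry ℤ._+_) (∈-cartesianProduct⁺ a∈ b∈)
    T : Tiling n (InA A) (InB B)
    T = record { bounded = sum∈⁻ ; covers = covers ; unique = unique }
    A⊆ : ∀ {z} → z ∈ A → z ∈ encodeA (InA? A) n
    A⊆ z∈ with x , refl , x<n ← A-elem z∈ = ∈-encodeA⁺ (InA? A) x<n z∈
    A⊇ : ∀ z → z ∈ encodeA (InA? A) n → z ∈ A
    A⊇ z z∈ with _ , refl , _ , a∈ ← ∈-encodeA⁻ (InA? A) {n} z∈ = a∈
    B⊆ : ∀ {z} → z ∈ B → z ∈ encodeB (InB? B) n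
    B⊆ z∈ with y , refl , y<n ← B-elem z∈ = ∈-encodeB⁺ (InB? B) y<n z∈
    B⊇ : ∀ z → z ∈ encodeB (InB? B) n → z ∈ B
    B⊇ z z∈ with _ , refl , _ , b∈ ← ∈-encodeB⁻ (InB? B) {n} z∈ = b∈

module _ {n X Y} (X? : Decidable X) (Y? : Decidable Y) (T : Tiling n X Y) (0<n : 0 < n) where
  open Tiling T

  InA-encodeA : ∀ x → InA (encodeA X? n) x ⇔ X x
  InA-encodeA x = mk⇔
    (λ x∈ → let _ , e , _ , Xx′ = ∈-encodeA⁻ X? {n} x∈ in subst X (sym (+suc-injective e)) Xx′)
    (λ Xx → ∈-encodeA⁺ X? (subst (_< n) (+-identityʳ x) (bounded Xx (0∈Y 0<n))) Xx)

  InB-encodeB : ∀ y → InB (encodeB Y? n) y ⇔ Y y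
  InB-encodeB y = mk⇔
    (λ y∈ → let _ , e , _ , Yy′ = ∈-encodeB⁻ Y? {n} y∈ in subst Y (sym (ℤP.+-injective e)) Yy′)
    (λ Yy → ∈-encodeB⁺ Y? (bounded (0∈X 0<n) Yy) Yy)

module _ {n A B} (d : Decoded n A B) where

  Decoded-A-positive : ∀ {z} → z ∈ A → ∃ λ x → z ≡ + suc x
  Decoded-A-positive {z} z∈ with x , z≡ , _ ← ∈-encodeA⁻ (InA? A) {n} (subst (z ∈_) (Decoded.A≡ d) z∈) = x , z≡

  Decoded-A≡ : ∀ {X} (X? : Decidable X) → (∀ x → InA A x ⇔ X x) → A ≡ encodeA X? n
  Decoded-A≡ X? A⇔X = trans (Decoded.A≡ d) (cong (map (λ x → + suc x)) (below-cong (InA? A) X? n (λ x _ → A⇔X x)))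

  Decoded-B≡ : ∀ {Y} (Y? : Decidable Y) → (∀ y → InB B y ⇔ Y y) → B ≡ encodeB Y? n
  Decoded-B≡ Y? B⇔Y = trans (Decoded.B≡ d) (cong (map (λ y → + y)) (below-cong (InB? B) Y? n (λ y _ → B⇔Y y)))

firstGap≡just : ∀ xs A {g} → firstGap xs A ≡ just g → g ∈ xs × g ∉ A
firstGap≡just (x ∷ xs) A e with x ∈? A
... | yes _  = let g∈xs , g∉A = firstGap≡just xs A e in there g∈xs , g∉A
... | no x∉A with refl ← e = here refl , x∉A

firstSeg-length≢1 : ∀ m A → Strict A → + 1 ∈ A → + 2 ∈ A → length (firstSeg m A) ≢ 1
firstSeg-length≢1 m A sA 1∈A 2∈A with firstGap (interval m) A in gap
... | nothing = λ e → <-irrefl (sym e) (Unique⇒2≤length (Strict⇒Unique sA) 1∈A 2∈A (λ ()))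
... | just g  = λ e → <-irrefl (sym e) (Unique⇒2≤length (Uniqueₚ.filter⁺ (ℤ._<? g) (Strict⇒Unique sA))
                        (∈-filter⁺ (ℤ._<? g) 1∈A (below-gap 0 z≤n))
                        (∈-filter⁺ (ℤ._<? g) 2∈A (below-gap 1 (s≤s z≤n))) (λ ()))
  where
    g∉A = proj₂ (firstGap≡just (interval m) A gap)
    i = proj₁ (∈-interval⁻ (proj₁ (firstGap≡just (interval m) A gap)))
    g≡ : g ≡ + suc i
    g≡ = proj₁ (proj₂ (∈-interval⁻ (proj₁ (firstGap≡just (interval m) A gap))))
    2≤i : 2 ≤ i
    2≤i with i | g≡
    ... | zero        | refl = ⊥-elim (g∉A 1∈A)
    ... | suc zero    | refl = ⊥-elim (g∉A 2∈A)
    ... | suc (suc _) | _    = s≤s (s≤s z≤n)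
    below-gap : ∀ k → k ≤ 1 → + suc k ℤ.< g
    below-gap k k≤1 = subst (+ suc k ℤ.<_) (sym g≡) (ℤ.+<+ (s≤s (≤-trans (s≤s k≤1) 2≤i)))

private
  firstGap≡2 : ∀ m A → + 1 ∈ A → + 2 ∉ A → firstGap (interval (suc (suc m))) A ≡ just (+ 2)
  firstGap≡2 m A 1∈A 2∉A with + 1 ∈? A | + 2 ∈? A
  ... | no 1∉A | _       = ⊥-elim (1∉A 1∈A)
  ... | yes _  | yes 2∈A = ⊥-elim (2∉A 2∈A)
  ... | yes _  | no _    = refl

firstSeg-length≡1 : ∀ m A → Strict A → (∀ {z} → z ∈ A → ∃ λ x → z ≡ + suc x) → + 1 ∈ A → + 2 ∉ A →
                    length (firstSeg (suc (suc m)) A) ≡ 1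
firstSeg-length≡1 m A sA A>0 1∈A 2∉A with firstGap (interval (suc (suc m))) A in gap
... | nothing with () ← trans (sym gap) (firstGap≡2 m A 1∈A 2∉A)
... | just g with refl ← trans (sym gap) (firstGap≡2 m A 1∈A 2∉A) =
  Unique-⊆⊇⇒length≡ (Uniqueₚ.filter⁺ (ℤ._<? + 2) (Strict⇒Unique sA)) ([] ∷ []) ⊆[1] [1]⊆
  where
    ⊆[1] : ∀ {z} → z ∈ filter (ℤ._<? + 2) A → z ∈ + 1 ∷ []
    ⊆[1] z∈ with z∈A , z<2 ← ∈-filter⁻ (ℤ._<? + 2) {xs = A} z∈ with A>0 z∈A
    ... | zero  , refl = here refl
    ... | suc _ , refl with ℤ.+<+ (s≤s (s≤s ())) ← z<2
    [1]⊆ : ∀ {z} → z ∈ + 1 ∷ [] → z ∈ filter (ℤ._<? + 2) A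
    [1]⊆ (here refl) = ∈-filter⁺ (ℤ._<? + 2) 1∈A (ℤ.+<+ (s≤s (s≤s z≤n)))

-- Nested tilings

module _ (K J : ℕ) .{{_ : NonZero K}} .{{_ : NonZero J}} where

  private
    [uJK]/K≡uJ : ∀ u → u * J * K / K ≡ u * J
    [uJK]/K≡uJ u = m*n/n≡m (u * J) K

  Blocks-Dilate-multiple : ∀ {Z : ℕ → Set} u → Blocks K (Dilate J Z) (u * J * K) ⇔ Z u
  Blocks-Dilate-multiple {Z} u = mk⇔ (λ (_ , Zu) → subst Z uJK/K/J≡u Zu)
    (λ Zu → trans (cong (_% J) ([uJK]/K≡uJ u)) (m*n%n≡0 u J) , subst Z (sym uJK/K/J≡u) Zu)
    where
      uJK/K/J≡u : u * J * K / K / J ≡ u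
      uJK/K/J≡u = trans (cong (_/ J) ([uJK]/K≡uJ u)) (m*n/n≡m u J)

  Dilate-Blocks-multiple : ∀ {W : ℕ → Set} v → Dilate K (Blocks J W) (v * J * K) ⇔ W v
  Dilate-Blocks-multiple {W} v = mk⇔ (λ (_ , Wv) → subst W vJK/K/J≡v Wv)
    (λ Wv → m*n%n≡0 (v * J) K , subst W (sym vJK/K/J≡v) Wv)
    where
      vJK/K/J≡v : v * J * K / K / J ≡ v
      vJK/K/J≡v = trans (cong (_/ J) ([uJK]/K≡uJ v)) (m*n/n≡m v J)

  Blocks-Dilate-<K : ∀ {Z : ℕ → Set} {x} → x < K → Z 0 → Blocks K (Dilate J Z) x
  Blocks-Dilate-<K {Z} x<K Z0 rewrite m<n⇒m/n≡0 x<K = m*n%n≡0 0 J , subst Z (sym (m*n/n≡m 0 J)) Z0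

  Blocks-Dilate-qK∉ : ∀ {Z : ℕ → Set} {q} → 0 < q → q < J → ¬ Blocks K (Dilate J Z) (q * K)
  Blocks-Dilate-qK∉ {Z} {q} 0<q q<J (qK/K%J≡0 , _) =
    <-irrefl (sym (trans (sym (m<n⇒m%n≡m q<J)) (trans (cong (_% J) (sym (m*n/n≡m q K))) qK/K%J≡0))) 0<q

  Blocks-Dilate-JK : ∀ {Z : ℕ → Set} → Z 1 → Blocks K (Dilate J Z) (J * K)
  Blocks-Dilate-JK {Z} Z1 = subst (Blocks K (Dilate J Z)) (cong (_* K) (*-identityˡ J)) (from (Blocks-Dilate-multiple {Z} 1) Z1)

Pair : Set
Pair = List ℤ × List ℤ

interval-pair : (K : ℕ) .{{_ : NonZero K}} → ℕ → Pair
interval-pair K n = encodeA (Blocks? K (_≟ 0)) n , encodeB (Dilate? K (_<? n / K)) n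

nested-pair : (K J : ℕ) .{{_ : NonZero K}} .{{_ : NonZero J}} → ℕ → Pair → Pair
nested-pair K J n (A , B) = encodeA (Blocks? K (Dilate? J (InA? A))) n , encodeB (Dilate? K (Blocks? J (InB? B))) n

length-below-initial-block : ∀ K .{{_ : NonZero K}} {m n} → 0 < n → n ≡ m * K →
                             length (below (Blocks? K (_≟ 0)) n) ≡ K
length-below-initial-block K {m} {n} 0<n n≡mK = subst (λ N → length (below (Blocks? K (_≟ 0)) N) ≡ K) (sym n≡mK)
  (trans (length-below-Blocks K m (_≟ 0)) (trans (cong (_* K) (length-below-≡0 0<m)) (*-identityˡ K)))
  where
    0<m : 0 < m
    0<m = *-cancelʳ-< K 0 m (subst (0 <_) n≡mK 0<n)

interval-pair-𝒯 : ∀ K .{{_ : NonZero K}} {n} → 0 < n → n ≡ n / K * K → 𝒯 K (interval n) (interval-pair K n)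
interval-pair-𝒯 K {n} 0<n n≡mK =
  subst (λ a → 𝒯 a (interval n) (interval-pair K n)) (length-below-initial-block K {n / K} 0<n n≡mK)
  (tiling⇒𝒯 (Blocks? K (_≟ 0)) (Dilate? K (_<? m))
    (subst (λ N → Tiling N (Blocks K (_≡ 0)) (Dilate K (_< m))) (sym n≡mK) (inflate K interval-tiling)) 0<n)
  where
    m = n / K
    interval-tiling : Tiling m (_≡ 0) (_< m)
    interval-tiling = record { bounded = λ { refl y<m → y<m } ; covers = λ z z<m → 0 , z , refl , z<m , refl
                             ; unique = λ { refl _ refl _ _ → refl } }

Decoded-length : ∀ {a m A B} → 𝒯 a (interval m) (A , B) → Decoded m A B → length (below (InA? A) m) ≡ a
Decoded-length {m = m} {A} (_ , _ , _ , _ , |A|≡a , _) d =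
  trans (sym (length-map _ (below (InA? A) m))) (trans (cong length (sym (Decoded.A≡ d))) |A|≡a)

nested-pair-𝒯 : ∀ K J .{{_ : NonZero K}} .{{_ : NonZero J}} {a m n A B} → 𝒯 a (interval m) (A , B) →
                0 < m → n ≡ m * J * K → 𝒯 (a * K) (interval n) (nested-pair K J n (A , B))
nested-pair-𝒯 K J {a} {m} {n} {A} {B} t 0<m n≡mJK = subst (λ a → 𝒯 a (interval n) (nested-pair K J n (A , B))) |X|≡aK
  (tiling⇒𝒯 X? (Dilate? K (Blocks? J (InB? B)))
    (subst (λ N → Tiling N (Blocks K (Dilate J (InA A))) (Dilate K (Blocks J (InB B)))) (sym n≡mJK)
    (inflate K (swap (inflate J (swap (Decoded.tiling d)))))) 0<n)
  where
    d = 𝒯⇒Decoded t 0<m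
    X? = Blocks? K (Dilate? J (InA? A))
    0<n : 0 < n
    0<n = subst (0 <_) (sym n≡mJK) (*-monoˡ-< K (*-monoˡ-< J 0<m))
    |X|≡aK : length (below X? n) ≡ a * K
    |X|≡aK = subst (λ N → length (below X? N) ≡ a * K) (sym n≡mJK)
      (trans (length-below-Blocks K (m * J) (Dilate? J (InA? A)))
             (cong (_* K) (trans (length-below-Dilate J m (InA? A)) (Decoded-length t d))))

-- In Blocks K (Dilate J Z) with 0, 1 ∈ Z the initial run has length K, and the next element is JK.
initial-run-≮ : ∀ {n K J K′ J′} .{{_ : NonZero K}} .{{_ : NonZero J}} .{{_ : NonZero K′}} .{{_ : NonZero J′}}
                {Z Z′ : ℕ → Set} → 1 < J → Z′ 0 → K < n →
                (∀ {x} → x < n → Blocks K′ (Dilate J′ Z′) x → Blocks K (Dilate J Z) x) → ¬ K < K′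
initial-run-≮ {K = K} {J} {K′} {J′} {Z} {Z′} 1<J Z′0 K<n transfer K<K′ = Blocks-Dilate-qK∉ K J {Z} (s≤s z≤n) 1<J
  (subst (Blocks K (Dilate J Z)) (sym (*-identityˡ K)) (transfer K<n (Blocks-Dilate-<K K′ J′ {Z′} K<K′ Z′0)))

second-run-≮ : ∀ {n K J J′} .{{_ : NonZero K}} .{{_ : NonZero J}} .{{_ : NonZero J′}} {Z Z′ : ℕ → Set} →
               Z 1 → J * K < n →
               (∀ {x} → x < n → Blocks K (Dilate J Z) x → Blocks K (Dilate J′ Z′) x) → ¬ J < J′
second-run-≮ {K = K} {J} {J′} {Z} {Z′} Z1 JK<n transfer J<J′ =
  Blocks-Dilate-qK∉ K J′ {Z′} (>-nonZero⁻¹ J) J<J′ (transfer JK<n (Blocks-Dilate-JK K J {Z} Z1))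

nested-pair-cancel : ∀ K J .{{_ : NonZero K}} .{{_ : NonZero J}} {m n A B A′ B′} → m * J * K ≤ n →
                     Decoded m A B → Decoded m A′ B′ →
                     nested-pair K J n (A , B) ≡ nested-pair K J n (A′ , B′) → (A , B) ≡ (A′ , B′)
nested-pair-cancel K J {m} {n} {A} {B} {A′} {B′} mJK≤n d d′ e = cong₂ _,_
  (trans (Decoded.A≡ d) (trans (cong (map (λ x → + suc x)) (below-cong (InA? A) (InA? A′) m A⇔A′)) (sym (Decoded.A≡ d′))))
  (trans (Decoded.B≡ d) (trans (cong (map (λ y → + y)) (below-cong (InB? B) (InB? B′) m B⇔B′)) (sym (Decoded.B≡ d′))))
  where
    bound : ∀ {u} → u < m → u * J * K < n
    bound u<m = <-≤-trans (*-monoˡ-< K (*-monoˡ-< J u<m)) mJK≤n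
    A⇔A′ : ∀ u → u < m → InA A u ⇔ InA A′ u
    A⇔A′ u u<m = mk⇔
      (λ u∈A → to (Blocks-Dilate-multiple K J {InA A′} u) (encodeA-≡⇒ X? X′? (cong proj₁ e) (bound u<m)
                  (from (Blocks-Dilate-multiple K J {InA A} u) u∈A)))
      (λ u∈A′ → to (Blocks-Dilate-multiple K J {InA A} u) (encodeA-≡⇒ X′? X? (sym (cong proj₁ e)) (bound u<m)
                  (from (Blocks-Dilate-multiple K J {InA A′} u) u∈A′)))
      where
        X? = Blocks? K (Dilate? J (InA? A))
        X′? = Blocks? K (Dilate? J (InA? A′))
    B⇔B′ : ∀ v → v < m → InB B v ⇔ InB B′ v
    B⇔B′ v v<m = mk⇔
      (λ v∈B → to (Dilate-Blocks-multiple K J {InB B′} v) (encodeB-≡⇒ Y? Y′? (cong proj₂ e) (bound v<m)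
                  (from (Dilate-Blocks-multiple K J {InB B} v) v∈B)))
      (λ v∈B′ → to (Dilate-Blocks-multiple K J {InB B} v) (encodeB-≡⇒ Y′? Y? (sym (cong proj₂ e)) (bound v<m)
                  (from (Dilate-Blocks-multiple K J {InB B′} v) v∈B′)))
      where
        Y? = Dilate? K (Blocks? J (InB? B))
        Y′? = Dilate? K (Blocks? J (InB? B′))

-- The enumeration

-- The hypotheses only count 𝒯(a, [m]) for a, m ≥ 1; elsewhere the listing is empty.
module _ {S : Set} {P : ℕ → ℕ → S → Set} {k : ℕ → ℕ → ℕ}
         (count : ∀ a m → 1 ≤ a → 1 ≤ m → HasCard (P a m) (k a m)) where

  listing : ℕ → ℕ → List S
  listing a m with 1 ≤? a | 1 ≤? m
  ... | yes 1≤a | yes 1≤m = proj₁ (count a m 1≤a 1≤m)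
  ... | _       | _       = []

  Unique-listing : ∀ a m → Unique (listing a m)
  Unique-listing a m with 1 ≤? a | 1 ≤? m
  ... | yes 1≤a | yes 1≤m = proj₁ (proj₂ (count a m 1≤a 1≤m))
  ... | yes _   | no _    = []
  ... | no _    | _       = []

  ∈-listing : ∀ {a m} → 1 ≤ a → 1 ≤ m → ∀ s → s ∈ listing a m ⇔ P a m s
  ∈-listing {a} {m} 1≤a 1≤m with 1 ≤? a | 1 ≤? m
  ... | yes 1≤a | yes 1≤m = proj₁ (proj₂ (proj₂ (count a m 1≤a 1≤m)))
  ... | no 1≰a  | _       = ⊥-elim (1≰a 1≤a)
  ... | yes _   | no 1≰m  = ⊥-elim (1≰m 1≤m)

  length-listing : ∀ {a m} → 1 ≤ a → 1 ≤ m → length (listing a m) ≡ k a m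
  length-listing {a} {m} 1≤a 1≤m with 1 ≤? a | 1 ≤? m
  ... | yes 1≤a | yes 1≤m = proj₂ (proj₂ (proj₂ (count a m 1≤a 1≤m)))
  ... | no 1≰a  | _       = ⊥-elim (1≰a 1≤a)
  ... | yes _   | no 1≰m  = ⊥-elim (1≰m 1≤m)

_≟ₚ_ : DecidableEquality Pair
_≟ₚ_ = ×P.≡-dec (List.≡-dec ℤ._≟_) (List.≡-dec ℤ._≟_)

module Enumeration (a′ n : ℕ) (0<n : 0 < n) (c c₁ : ℕ → ℕ → ℕ)
  (c-count  : ∀ a m → 1 ≤ a → 1 ≤ m → HasCard (𝒯 a (interval m)) (c a m))
  (c₁-count : ∀ a m → 1 ≤ a → 1 ≤ m → HasCard (𝒯₁ a m) (c₁ a m)) where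

  -- α in the form suc a′, so that k_s = α can be solved by unification in onto-interval
  α : ℕ
  α = suc a′

  -- k_s = suc i throughout
  𝓛 𝓛₁ : ℕ → ℕ → List Pair
  𝓛  i kr = listing c-count  (α / suc i) (n / (suc i + kr))
  𝓛₁ i kr = listing c₁-count (α / suc i) (n / (suc i + kr))

  fresh : ℕ → ℕ → List Pair
  fresh i kr = filter (λ p → ¬? (Any.any? (p ≟ₚ_) (𝓛₁ i kr))) (𝓛 i kr)

  Index : Set
  Index = ℕ × ℕ × Pair

  -- the interval tiling is indexed by the dummy pair ([] , [])
  block : ℕ → ℕ → List Index
  block i kr = if does (α ∣? n)
    then (if does (kr ≟ 0) then (i , kr , ([] , [])) ∷ [] else map (λ p → i , kr , p) (fresh i kr))
    else []

  block? : ℕ → ℕ → List Index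
  block? i kr = if does (InR? α n (suc i) kr) then block i kr else []

  blocks? : ℕ → List Index
  blocks? i = if does (suc i ∣? α) then concatMap (block? i) (upTo (suc (suc i * n))) else []

  -- indices mirrors the double sum RHS, so its length is RHS term by term
  indices : List Index
  indices = concatMap blocks? (upTo α)

  data Kind (i kr : ℕ) : Pair → Set where
    interval-kind : kr ≡ 0 → Kind i kr ([] , [])
    nested-kind   : ∀ {p} → kr ≢ 0 → p ∈ 𝓛 i kr → p ∉ 𝓛₁ i kr → Kind i kr p

  Valid : Index → Set
  Valid (i , kr , p) = i < α × suc i ∣ α × kr < suc (suc i * n) × InR α n (suc i) kr × α ∣ n × Kind i kr p

  private
    ∈-block⁻ : ∀ {i kr t} → t ∈ block i kr → α ∣ n × ∃ λ p → t ≡ (i , kr , p) × Kind i kr p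
    ∈-block⁻ {i} {kr} t∈ with α∣n , t∈′ ← ∈-if⁻ (α ∣? n) t∈ with ∈-if-else⁻ (kr ≟ 0) t∈′
    ... | inj₁ (kr≡0 , here refl) = α∣n , _ , refl , interval-kind kr≡0
    ... | inj₂ (kr≢0 , t∈″) with p , p∈ , refl ← ∈-map⁻ (λ p → i , kr , p) t∈″
                           with p∈𝓛 , p∉𝓛₁ ← ∈-filter⁻ (λ p → ¬? (Any.any? (p ≟ₚ_) (𝓛₁ i kr))) {xs = 𝓛 i kr} p∈ =
      α∣n , p , refl , nested-kind kr≢0 p∈𝓛 p∉𝓛₁

    ∈-block⁺ : ∀ {i kr p} → α ∣ n → Kind i kr p → (i , kr , p) ∈ block i kr
    ∈-block⁺ {i} {kr} α∣n kind = ∈-if⁺ (α ∣? n) α∣n (in-kind kind)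
      where
        in-kind : ∀ {p} → Kind i kr p →
                  (i , kr , p) ∈ (if does (kr ≟ 0) then (i , kr , ([] , [])) ∷ [] else map (λ p → i , kr , p) (fresh i kr))
        in-kind (interval-kind kr≡0)       = ∈-if-else⁺ˡ (kr ≟ 0) kr≡0 (here refl)
        in-kind (nested-kind kr≢0 p∈ p∉) = ∈-if-else⁺ʳ (kr ≟ 0) kr≢0
          (∈-map⁺ (λ p → i , kr , p) (∈-filter⁺ (λ p → ¬? (Any.any? (p ≟ₚ_) (𝓛₁ i kr))) p∈ p∉))

  ∈-indices⁻ : ∀ {t} → t ∈ indices → Valid t
  ∈-indices⁻ t∈ with i , i∈ , t∈₁ ← find (∈-concatMap⁻ blocks? {xs = upTo α} t∈)
                with K∣α , t∈₂ ← ∈-if⁻ (suc i ∣? α) t∈₁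
                with kr , kr∈ , t∈₃ ← find (∈-concatMap⁻ (block? i) {xs = upTo (suc (suc i * n))} t∈₂)
                with inR , t∈₄ ← ∈-if⁻ (InR? α n (suc i) kr) t∈₃
                with α∣n , p , refl , kind ← ∈-block⁻ {i} {kr} t∈₄ =
    ∈-upTo⁻ i∈ , K∣α , ∈-upTo⁻ kr∈ , inR , α∣n , kind

  ∈-indices⁺ : ∀ {t} → Valid t → t ∈ indices
  ∈-indices⁺ {i , kr , p} (i<α , K∣α , kr≤ , inR , α∣n , kind) =
    ∈-concatMap⁺ blocks? (lose (∈-upTo⁺ i<α) (∈-if⁺ (suc i ∣? α) K∣α
      (∈-concatMap⁺ (block? i) (lose (∈-upTo⁺ kr≤) (∈-if⁺ (InR? α n (suc i) kr) inR (∈-block⁺ α∣n kind))))))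

  private
    Unique-block : ∀ i kr → Unique (block i kr)
    Unique-block i kr = Unique-if (α ∣? n) (by-kind (kr ≟ 0))
      where
        by-kind : (kr≟0 : Dec (kr ≡ 0)) →
                  Unique (if does kr≟0 then (i , kr , ([] , [])) ∷ [] else map (λ p → i , kr , p) (fresh i kr))
        by-kind (yes _) = [] ∷ []
        by-kind (no _)  = Uniqueₚ.map⁺ (cong (λ t → proj₂ (proj₂ t))) (Uniqueₚ.filter⁺ (λ p → ¬? (Any.any? (p ≟ₚ_) (𝓛₁ i kr)))
                                                                        (Unique-listing c-count (α / suc i) (n / (suc i + kr))))

    index-of-block : ∀ i kr {t} → t ∈ block? i kr → proj₁ t ≡ i × proj₁ (proj₂ t) ≡ kr
    index-of-block i kr t∈ with _ , _ , refl , _ ← ∈-block⁻ {i} {kr} (proj₂ (∈-if⁻ (InR? α n (suc i) kr) t∈)) =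
      refl , refl

    Unique-blocks? : ∀ i → Unique (blocks? i)
    Unique-blocks? i = Unique-if (suc i ∣? α) (Unique-concatMap⁺ (λ t → proj₁ (proj₂ t)) (Uniqueₚ.upTo⁺ (suc (suc i * n)))
      (λ kr → Unique-if (InR? α n (suc i) kr) (Unique-block i kr)) (λ kr t∈ → proj₂ (index-of-block i kr t∈)))

  Unique-indices : Unique indices
  Unique-indices = Unique-concatMap⁺ proj₁ (Uniqueₚ.upTo⁺ α) Unique-blocks? tagged
    where
      tagged : ∀ i {t} → t ∈ blocks? i → proj₁ t ≡ i
      tagged i t∈
        with kr , _ , t∈′ ← find (∈-concatMap⁻ (block? i) {xs = upTo (suc (suc i * n))} (proj₂ (∈-if⁻ (suc i ∣? α) t∈))) =
        proj₁ (index-of-block i kr t∈′)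

  private
    α/K≥1 : ∀ {i} → suc i ∣ α → 1 ≤ α / suc i
    α/K≥1 K∣α = m≥n⇒m/n>0 (∣⇒≤ K∣α)

    K+kr∣n : ∀ {i kr} → suc i ∣ α → α * (suc i + kr) ∣ suc i * n → (suc i + kr) ∣ n
    K+kr∣n {i} {kr} (divides a α≡aK) (divides e Kn≡eα[K+kr]) = divides (e * a) (*-cancelˡ-≡ n _ (suc i)
      (trans Kn≡eα[K+kr] (trans (cong (λ t → e * (t * (suc i + kr))) α≡aK) (regroup e a (suc i) (suc i + kr)))))
      where
        regroup : ∀ e a k s → e * ((a * k) * s) ≡ k * ((e * a) * s)
        regroup = solve-∀

    n/[K+kr]≥1 : ∀ {i kr} → suc i ∣ α → α * (suc i + kr) ∣ suc i * n → 1 ≤ n / (suc i + kr)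
    n/[K+kr]≥1 K∣α α[K+kr]∣Kn = m≥n⇒m/n>0 (∣⇒≤ ⦃ >-nonZero 0<n ⦄ (K+kr∣n K∣α α[K+kr]∣Kn))

    length-fresh : ∀ i kr → 1 ≤ α / suc i → 1 ≤ n / (suc i + kr) →
                   length (fresh i kr) ≡ c (α / suc i) (n / (suc i + kr)) ∸ c₁ (α / suc i) (n / (suc i + kr))
    length-fresh i kr 1≤a 1≤m =
      trans (length-filter-∉ _≟ₚ_ (Unique-listing c-count (α / suc i) (n / (suc i + kr)))
                                  (Unique-listing c₁-count (α / suc i) (n / (suc i + kr))) 𝓛₁⊆𝓛)
            (cong₂ _∸_ (length-listing c-count 1≤a 1≤m) (length-listing c₁-count 1≤a 1≤m))
      where
        𝓛₁⊆𝓛 : ∀ {p} → p ∈ 𝓛₁ i kr → p ∈ 𝓛 i kr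
        𝓛₁⊆𝓛 {p} p∈ = from (∈-listing c-count 1≤a 1≤m p) (proj₁ (to (∈-listing c₁-count 1≤a 1≤m p) p∈))

    length-block : ∀ i kr → suc i ∣ α → InR α n (suc i) kr → length (block i kr) ≡ Ψ c c₁ α n i kr
    length-block i kr K∣α (_ , α[K+kr]∣Kn , _) = length-if (α ∣? n) (λ _ → by-kind (kr ≟ 0))
      where
        by-kind : (kr≟0 : Dec (kr ≡ 0)) →
          length (if does kr≟0 then (i , kr , ([] , [])) ∷ [] else map (λ p → i , kr , p) (fresh i kr)) ≡
          (if does kr≟0 then 1 else c (α / suc i) (n / (suc i + kr)) ∸ c₁ (α / suc i) (n / (suc i + kr)))
        by-kind (yes _) = refl
        by-kind (no _)  = trans (List.length-map _ (fresh i kr))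
                                (length-fresh i kr (α/K≥1 K∣α) (n/[K+kr]≥1 K∣α α[K+kr]∣Kn))

  length-indices : length indices ≡ RHS c c₁ α n
  length-indices = trans (length-concatMap blocks? (upTo α)) (cong sum (List.map-cong length-blocks? (upTo α)))
    where
      length-blocks? : ∀ i → length (blocks? i) ≡
        (if does (suc i ∣? α)
          then sum (map (λ kr → if does (InR? α n (suc i) kr) then Ψ c c₁ α n i kr else 0) (upTo (suc (suc i * n))))
          else 0)
      length-blocks? i = length-if (suc i ∣? α) λ K∣α →
        trans (length-concatMap (block? i) (upTo (suc (suc i * n))))
              (cong sum (List.map-cong (λ kr → length-if (InR? α n (suc i) kr) (length-block i kr K∣α))
                                       (upTo (suc (suc i * n)))))

  -- k_r = (J - 1) k_s: the nested tiling uses K = k_s and J = 1 + k_r / k_s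
  J : ℕ → ℕ → ℕ
  J i kr = suc (kr / suc i)

  decode : Index → Pair
  decode (i , kr , p) = if does (kr ≟ 0) then interval-pair α n else nested-pair (suc i) (J i kr) n p

  decode-nested : ∀ i kr p → kr ≢ 0 → decode (i , kr , p) ≡ nested-pair (suc i) (J i kr) n p
  decode-nested i zero    p kr≢0 = ⊥-elim (kr≢0 refl)
  decode-nested i (suc _) p _    = refl

  record NestedIndex (i kr : ℕ) (A B : List ℤ) : Set where
    field
      a m    : ℕ
      α≡aK   : α ≡ a * suc i
      n≡mJK  : n ≡ m * J i kr * suc i
      kr≡jK  : kr ≡ kr / suc i * suc i
      j≥1    : 1 ≤ kr / suc i
      K<α    : suc i < α
      𝒯AB    : 𝒯 a (interval m) (A , B)
      2≤m    : 2 ≤ m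
      1∈A    : + 1 ∈ A
      2∈A    : + 2 ∈ A

    0<m : 0 < m
    0<m = <-trans (s≤s z≤n) 2≤m

    decoded : Decoded m A B
    decoded = 𝒯⇒Decoded 𝒯AB 0<m

    JK<n : J i kr * suc i < n
    JK<n = subst₂ _<_ (cong (_* suc i) (*-identityˡ (J i kr))) (sym n≡mJK) (*-monoˡ-< (suc i) (*-monoˡ-< (J i kr) 2≤m))

    K<n : suc i < n
    K<n = ≤-<-trans (m≤n*m (suc i) (J i kr)) JK<n

  nested-index : ∀ {i kr A B} → suc i ∣ α → InR α n (suc i) kr → kr ≢ 0 →
                 (A , B) ∈ 𝓛 i kr → (A , B) ∉ 𝓛₁ i kr → NestedIndex i kr A B
  nested-index {i} {kr} {A} {B} K∣α (K∣kr , α[K+kr]∣Kn , K≡α⇒kr≡0 , _) kr≢0 p∈ p∉ = record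
    { a = a ; m = m ; α≡aK = sym (m/n*n≡m K∣α) ; n≡mJK = n≡mJK ; kr≡jK = kr≡jK ; j≥1 = j≥1 ; K<α = K<α
    ; 𝒯AB = 𝒯AB ; 2≤m = 2≤m ; 1∈A = Tiling.0∈X (Decoded.tiling decoded) 0<m ; 2∈A = 2∈A }
    where
      K = suc i
      j = kr / K
      a = α / K
      m = n / (K + kr)
      1≤a = α/K≥1 K∣α
      1≤m = n/[K+kr]≥1 K∣α α[K+kr]∣Kn
      0<m = 1≤m
      kr≡jK : kr ≡ j * K
      kr≡jK = sym (m/n*n≡m K∣kr)
      n≡mJK : n ≡ m * suc j * K
      n≡mJK = trans (sym (m/n*n≡m (K+kr∣n K∣α α[K+kr]∣Kn)))
                (trans (cong (λ t → m * (K + t)) kr≡jK) (sym (*-assoc m (suc j) K)))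
      j≥1 : 1 ≤ j
      j≥1 = n≢0⇒n>0 (λ j≡0 → kr≢0 (trans kr≡jK (cong (_* K) j≡0)))
      K<α : K < α
      K<α = ≤∧≢⇒< (∣⇒≤ K∣α) (λ K≡α → kr≢0 (K≡α⇒kr≡0 K≡α))
      𝒯AB : 𝒯 a (interval m) (A , B)
      𝒯AB = to (∈-listing c-count 1≤a 1≤m (A , B)) p∈
      decoded = 𝒯⇒Decoded 𝒯AB 0<m
      -- |A| = α / K ≥ 2 and 0 ∈ B, so m = |A| |B| ≥ 2
      2≤m : 2 ≤ m
      2≤m with _ , _ , _ , |[m]|≡|A||B| , |A|≡a , 0∈B , _ ← 𝒯AB =
        subst (2 ≤_) (trans (sym |[m]|≡|A||B|) (length-interval m))
          (*-mono-≤ (subst (2 ≤_) (sym |A|≡a) 2≤a) (∈-length 0∈B))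
        where
          2≤a : 2 ≤ a
          2≤a = *-cancelʳ-< K 1 a (subst₂ _<_ (sym (*-identityˡ K)) (sym (m/n*n≡m K∣α)) K<α)
      -- otherwise the first segment of A is {1}, i.e. (A , B) ∈ 𝒯(a, [m], (1,·))
      2∈A : + 2 ∈ A
      2∈A with + 2 ∈? A
      ... | yes 2∈A = 2∈A
      ... | no 2∉A = ⊥-elim (p∉ (from (∈-listing c₁-count 1≤a 1≤m (A , B)) (𝒯AB , first-run 2≤m)))
        where
          first-run : ∀ {m′} → 2 ≤ m′ → length (firstSeg m′ A) ≡ 1
          first-run {suc zero}     (s≤s ())
          first-run {suc (suc m′)} _ = firstSeg-length≡1 m′ A (proj₁ 𝒯AB) (Decoded-A-positive decoded)
                                                         (Tiling.0∈X (Decoded.tiling decoded) 0<m) 2∉A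

  decode-sound : ∀ {t} → Valid t → 𝒯 α (interval n) (decode t)
  decode-sound (_ , _ , _ , _ , α∣n , interval-kind refl) = interval-pair-𝒯 α 0<n (sym (m/n*n≡m α∣n))
  decode-sound {i , kr , (A , B)} (_ , K∣α , _ , inR , _ , nested-kind kr≢0 p∈ p∉) =
    subst (𝒯 α (interval n)) (sym (decode-nested i kr (A , B) kr≢0))
      (subst (λ a → 𝒯 a (interval n) (nested-pair (suc i) (J i kr) n (A , B))) (sym α≡aK)
        (nested-pair-𝒯 (suc i) (J i kr) 𝒯AB 0<m n≡mJK))
    where open NestedIndex (nested-index K∣α inR kr≢0 p∈ p∉)

  private
    interval≢nested : ∀ {i kr A B} → NestedIndex i kr A B → interval-pair α n ≢ nested-pair (suc i) (J i kr) n (A , B)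
    interval≢nested {i} {kr} {A} N e = Blocks-Dilate-qK∉ (suc i) (J i kr) {InA A} (s≤s z≤n) (s≤s j≥1)
      (subst (Blocks (suc i) (Dilate (J i kr) (InA A))) (sym (*-identityˡ (suc i)))
        (encodeA-≡⇒ (Blocks? α (_≟ 0)) (Blocks? (suc i) (Dilate? (J i kr) (InA? A))) (cong proj₁ e) K<n (m<n⇒m/n≡0 K<α)))
      where open NestedIndex N

    same-K : ∀ {i kr A B i′ kr′ A′ B′} → NestedIndex i kr A B → NestedIndex i′ kr′ A′ B′ →
             nested-pair (suc i) (J i kr) n (A , B) ≡ nested-pair (suc i′) (J i′ kr′) n (A′ , B′) → i ≡ i′
    same-K {i} {kr} {A} {_} {i′} {kr′} {A′} N N′ e = suc-injective (≤-antisym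
      (≮⇒≥ (initial-run-≮ {K = suc i′} {Z = InA A′} {InA A} (s≤s N′.j≥1) N.1∈A N′.K<n
             (encodeA-≡⇒ X? X′? (cong proj₁ e))))
      (≮⇒≥ (initial-run-≮ {K = suc i} {Z = InA A} {InA A′} (s≤s N.j≥1) N′.1∈A N.K<n
             (encodeA-≡⇒ X′? X? (sym (cong proj₁ e))))))
      where
        module N = NestedIndex N
        module N′ = NestedIndex N′
        X? = Blocks? (suc i) (Dilate? (J i kr) (InA? A))
        X′? = Blocks? (suc i′) (Dilate? (J i′ kr′) (InA? A′))

    same-kr : ∀ {i kr A B kr′ A′ B′} → NestedIndex i kr A B → NestedIndex i kr′ A′ B′ →
              nested-pair (suc i) (J i kr) n (A , B) ≡ nested-pair (suc i) (J i kr′) n (A′ , B′) → kr ≡ kr′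
    same-kr {i} {kr} {A} {_} {kr′} {A′} N N′ e =
      trans N.kr≡jK (trans (cong (_* suc i) (suc-injective J≡J′)) (sym N′.kr≡jK))
      where
        module N = NestedIndex N
        module N′ = NestedIndex N′
        X? = Blocks? (suc i) (Dilate? (J i kr) (InA? A))
        X′? = Blocks? (suc i) (Dilate? (J i kr′) (InA? A′))
        J≡J′ : J i kr ≡ J i kr′
        J≡J′ = ≤-antisym
          (≮⇒≥ (second-run-≮ {J = J i kr′} {Z = InA A′} {InA A} N′.2∈A N′.JK<n
                 (encodeA-≡⇒ X′? X? (sym (cong proj₁ e)))))
          (≮⇒≥ (second-run-≮ {J = J i kr} {Z = InA A} {InA A′} N.2∈A N.JK<n (encodeA-≡⇒ X? X′? (cong proj₁ e))))

    nested-injective : ∀ {i kr A B i′ kr′ A′ B′} → NestedIndex i kr A B → NestedIndex i′ kr′ A′ B′ →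
      nested-pair (suc i) (J i kr) n (A , B) ≡ nested-pair (suc i′) (J i′ kr′) n (A′ , B′) →
      (i , kr , (A , B)) ≡ (i′ , kr′ , (A′ , B′))
    nested-injective {i} {kr} N N′ e with refl ← same-K N N′ e with refl ← same-kr N N′ e =
      cong (λ p → i , kr , p)
        (nested-pair-cancel (suc i) (J i kr) (≤-reflexive (sym N.n≡mJK))
                            N.decoded (subst (λ m → Decoded m _ _) m′≡m N′.decoded) e)
      where
        module N = NestedIndex N
        module N′ = NestedIndex N′
        m′≡m : N′.m ≡ N.m
        m′≡m = *-cancelʳ-≡ _ _ (J i kr) (*-cancelʳ-≡ _ _ (suc i) (trans (sym N′.n≡mJK) N.n≡mJK))

  decode-injective : ∀ {t t′} → Valid t → Valid t′ → decode t ≡ decode t′ → t ≡ t′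
  decode-injective (_ , _ , _ , (_ , _ , _ , kr≡0⇒K≡α) , _ , interval-kind refl)
                   (_ , _ , _ , (_ , _ , _ , kr′≡0⇒K′≡α) , _ , interval-kind refl) _ =
    cong (λ i → i , 0 , ([] , [])) (suc-injective (trans (kr≡0⇒K≡α refl) (sym (kr′≡0⇒K′≡α refl))))
  decode-injective {t′ = i′ , kr′ , p′} (_ , _ , _ , _ , _ , interval-kind refl)
                   (_ , K∣α , _ , inR , _ , nested-kind kr≢0 p∈ p∉) e =
    ⊥-elim (interval≢nested (nested-index K∣α inR kr≢0 p∈ p∉) (trans e (decode-nested i′ kr′ p′ kr≢0)))
  decode-injective {i , kr , p} (_ , K∣α , _ , inR , _ , nested-kind kr≢0 p∈ p∉)
                   (_ , _ , _ , _ , _ , interval-kind refl) e =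
    ⊥-elim (interval≢nested (nested-index K∣α inR kr≢0 p∈ p∉) (trans (sym e) (decode-nested i kr p kr≢0)))
  decode-injective {i , kr , p} {i′ , kr′ , p′} (_ , K∣α , _ , inR , _ , nested-kind kr≢0 p∈ p∉)
                   (_ , K∣α′ , _ , inR′ , _ , nested-kind kr′≢0 p′∈ p′∉) e =
    nested-injective (nested-index K∣α inR kr≢0 p∈ p∉) (nested-index K∣α′ inR′ kr′≢0 p′∈ p′∉)
      (trans (sym (decode-nested i kr p kr≢0)) (trans e (decode-nested i′ kr′ p′ kr′≢0)))

  Preimage : Pair → Set
  Preimage p = ∃ λ t → Valid t × decode t ≡ p

  private
    onto-interval : ∀ {A B} → 𝒯 α (interval n) (A , B) → (d : Decoded n A B) → ∀ k m → n ≡ m * suc k →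
                    (∀ x → InA A x ⇔ x / suc k ≡ 0) → (∀ y → InB B y ⇔ Dilate (suc k) (_< m) y) → Preimage (A , B)
    onto-interval {A} {B} t d k m n≡mK A⇔ B⇔
      with refl ← suc-injective (trans (sym (Decoded-length t d))
                    (trans (cong length (below-cong (InA? A) (Blocks? (suc k) (_≟ 0)) n (λ x _ → A⇔ x)))
                           (length-below-initial-block (suc k) {m} 0<n n≡mK))) =
      (a′ , 0 , ([] , [])) ,
      (≤-refl , ∣-refl , s≤s z≤n , inR , divides m n≡mK , interval-kind refl) ,
      sym (cong₂ _,_ (Decoded-A≡ d (Blocks? α (_≟ 0)) A⇔) (Decoded-B≡ d (Dilate? α (_<? n / α)) B⇔′))
      where
        inR : InR α n α 0
        inR = divides 0 refl , *-monoʳ-∣ α (divides m (trans n≡mK (cong (m *_) (sym (+-identityʳ α))))) ,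
              (λ _ → refl) , (λ _ → refl)
        m≡n/α : m ≡ n / α
        m≡n/α = sym (trans (cong (_/ α) n≡mK) (m*n/n≡m m α))
        B⇔′ : ∀ y → InB B y ⇔ Dilate α (_< n / α) y
        B⇔′ y = ⇔.trans (B⇔ y) (Dilate-cong α (λ w → mk⇔ (subst (w <_) m≡n/α) (subst (w <_) (sym m≡n/α))) y)

    onto-nested : ∀ {A B} → 𝒯 α (interval n) (A , B) → (d : Decoded n A B) →
                  ∀ k j m {X′ Y′} (X′? : Decidable X′) (Y′? : Decidable Y′) →
                  n ≡ m * suc (suc j) * suc k → Tiling m X′ Y′ → X′ 1 →
                  (∀ x → InA A x ⇔ Blocks (suc k) (Dilate (suc (suc j)) X′) x) →
                  (∀ y → InB B y ⇔ Dilate (suc k) (Blocks (suc (suc j)) Y′) y) → Preimage (A , B)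
    onto-nested {A} {B} t d k j m {X′} {Y′} X′? Y′? n≡mJK T′ X′1 A⇔ B⇔ =
      (k , kr , (A′ , B′)) ,
      (<⇒≤ K<α , divides a α≡aK , s≤s (≤-trans kr≤n (m≤n*m n K)) , inR , divides (b * J₀) n≡bJα ,
       nested-kind (λ ()) p∈ p∉) ,
      trans (decode-nested k kr (A′ , B′) (λ ())) (trans (cong (λ z → nested-pair K (suc z) n (A′ , B′)) kr/K≡1+j)
        (sym (cong₂ _,_ (Decoded-A≡ d (Blocks? K (Dilate? J₀ (InA? A′))) A⇔′)
                        (Decoded-B≡ d (Dilate? K (Blocks? J₀ (InB? B′))) B⇔′))))
      where
        K = suc k
        J₀ = suc (suc j)
        kr = suc j * K
        A′ = encodeA X′? m
        B′ = encodeB Y′? m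
        a = length (below X′? m)
        b = length (below Y′? m)
        0<m : 0 < m
        0<m = n≢0⇒n>0 λ { refl → <-irrefl (sym n≡mJK) 0<n }
        0∈X′ = Tiling.0∈X T′ 0<m
        1<m : 1 < m
        1<m = subst (_< m) (+-identityʳ 1) (Tiling.bounded T′ X′1 (Tiling.0∈Y T′ 0<m))
        α≡aK : α ≡ a * K
        α≡aK = trans (sym (Decoded-length t d))
                 (trans (cong length (below-cong (InA? A) (Blocks? K (Dilate? J₀ X′?)) n (λ x _ → A⇔ x)))
                 (subst (λ N → length (below (Blocks? K (Dilate? J₀ X′?)) N) ≡ a * K) (sym n≡mJK)
                   (trans (length-below-Blocks K (m * J₀) (Dilate? J₀ X′?)) (cong (_* K) (length-below-Dilate J₀ m X′?)))))
        K<α : K < α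
        K<α = subst (K <_) (sym α≡aK) (subst (_< a * K) (*-identityˡ K) (*-monoˡ-< K
                (Unique⇒2≤length (Unique-below X′? m) (∈-below⁺ X′? 0<m 0∈X′) (∈-below⁺ X′? 1<m X′1) (λ ()))))
        n≡abJK : n ≡ a * b * J₀ * K
        n≡abJK = trans n≡mJK (cong (λ t → t * J₀ * K) (sym (Tiling-size X′? Y′? T′)))
        n≡bJα : n ≡ b * J₀ * α
        n≡bJα = trans n≡abJK (trans (solve-∀′ a b J₀ K) (cong (b * J₀ *_) (sym α≡aK)))
          where
            solve-∀′ : ∀ a b J₀ K → a * b * J₀ * K ≡ b * J₀ * (a * K)
            solve-∀′ = solve-∀
        kr≤n : kr ≤ n
        kr≤n = subst (kr ≤_) (sym n≡mJK) (*-monoˡ-≤ K (≤-trans (n≤1+n (suc j)) (m≤n*m J₀ m ⦃ >-nonZero 0<m ⦄)))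
        inR : InR α n K kr
        inR = divides (suc j) refl , divides b Kn≡b[α[K+kr]] , (λ K≡α → ⊥-elim (<-irrefl K≡α K<α)) , (λ ())
          where
            regroup : ∀ a b J₀ K → K * (a * b * J₀ * K) ≡ b * (a * K * (J₀ * K))
            regroup = solve-∀
            Kn≡b[α[K+kr]] : K * n ≡ b * (α * (K + kr))
            Kn≡b[α[K+kr]] = trans (cong (K *_) n≡abJK)
                              (trans (regroup a b J₀ K) (cong (λ t → b * (t * (J₀ * K))) (sym α≡aK)))
        α/K≡a : α / K ≡ a
        α/K≡a = trans (cong (_/ K) α≡aK) (m*n/n≡m a K)
        n/[K+kr]≡m : n / (K + kr) ≡ m
        n/[K+kr]≡m = trans (cong (_/ (J₀ * K)) (trans n≡mJK (*-assoc m J₀ K))) (m*n/n≡m m (J₀ * K))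
        kr/K≡1+j : kr / K ≡ suc j
        kr/K≡1+j = m*n/n≡m (suc j) K
        1≤α/K : 1 ≤ α / K
        1≤α/K = m≥n⇒m/n>0 (<⇒≤ K<α)
        1≤n/[K+kr] : 1 ≤ n / (K + kr)
        1≤n/[K+kr] = subst (1 ≤_) (sym n/[K+kr]≡m) 0<m
        p∈ : (A′ , B′) ∈ 𝓛 k kr
        p∈ = from (∈-listing c-count 1≤α/K 1≤n/[K+kr] (A′ , B′))
               (subst₂ (λ a m → 𝒯 a (interval m) (A′ , B′)) (sym α/K≡a) (sym n/[K+kr]≡m) (tiling⇒𝒯 X′? Y′? T′ 0<m))
        p∉ : (A′ , B′) ∉ 𝓛₁ k kr
        p∉ p∈₁ = firstSeg-length≢1 m A′ (Strict-encodeA X′? m) (∈-encodeA⁺ X′? 0<m 0∈X′) (∈-encodeA⁺ X′? 1<m X′1)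
                   (subst (λ m → length (firstSeg m A′) ≡ 1) n/[K+kr]≡m
                          (proj₂ (to (∈-listing c₁-count 1≤α/K 1≤n/[K+kr] (A′ , B′)) p∈₁)))
        A⇔′ : ∀ x → InA A x ⇔ Blocks K (Dilate J₀ (InA A′)) x
        A⇔′ x = ⇔.trans (A⇔ x) (Dilate-cong J₀ (λ u → ⇔.sym (InA-encodeA X′? Y′? T′ 0<m u)) (x / K))
        B⇔′ : ∀ y → InB B y ⇔ Dilate K (Blocks J₀ (InB B′)) y
        B⇔′ y = ⇔.trans (B⇔ y) (Dilate-cong K (λ w → ⇔.sym (InB-encodeB X′? Y′? T′ 0<m (w / J₀))) y)

  decode-onto : ∀ {p} → 𝒯 α (interval n) p → Preimage p
  decode-onto {A , B} t with d ← 𝒯⇒Decoded t 0<n with classify (InA? A) (InB? B) (Decoded.tiling d) 0<n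
  ... | interval-shape k m n≡mK A⇔ B⇔                 = onto-interval t d k m n≡mK A⇔ B⇔
  ... | nested-shape k j m X′? Y′? n≡mJK T′ X′1 A⇔ B⇔ =
    onto-nested t d k j m X′? Y′? n≡mJK T′ X′1 A⇔ B⇔

  enumeration : HasCard (𝒯 α (interval n)) (RHS c c₁ α n)
  enumeration = map decode indices ,
    Unique-map⁺ Unique-indices (λ t∈ t′∈ → decode-injective (∈-indices⁻ t∈) (∈-indices⁻ t′∈)) ,
    (λ p → mk⇔ (sound p) (complete p)) ,
    trans (List.length-map decode indices) length-indices
    where
      sound : ∀ p → p ∈ map decode indices → 𝒯 α (interval n) p
      sound p p∈ with t , t∈ , refl ← ∈-map⁻ decode p∈ = decode-sound (∈-indices⁻ t∈)
      complete : ∀ p → 𝒯 α (interval n) p → p ∈ map decode indices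
      complete p 𝒯p with t , valid , refl ← decode-onto 𝒯p = ∈-map⁺ decode (∈-indices⁺ valid)

lemma2 : (α n : ℕ) → 1 ≤ α → 1 ≤ n →
    (c c₁ : ℕ → ℕ → ℕ) →
    (∀ a m → 1 ≤ a → 1 ≤ m → HasCard (𝒯 a (interval m)) (c a m)) →
    (∀ a m → 1 ≤ a → 1 ≤ m → HasCard (𝒯₁ a m) (c₁ a m)) →
    HasCard (𝒯 α (interval n)) (RHS c c₁ α n)
lemma2 (suc a′) n _ 0<n c c₁ c-count c₁-count = Enumeration.enumeration a′ n 0<n c c₁ c-count c₁-count
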